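{- Let $w\in S_n$ have primary column data $(h,C,\alpha,i_1,\beta)$ and let $\sigma=\sigma(w)\in S_\beta$. Suppose $\bm{k}(w_{\mathrm{sort}})=(k_1,\ldots,k_n)$ and write $\bm{k}(\sigma)=(\bm{k}(\sigma)_1,\ldots,\bm{k}(\sigma)_\beta)$. Then $\bm{i}(w)=\bm{i}(w_{\mathrm{sort}})$, $\bm{m}(w)=\bm{m}(w_{\mathrm{sort}})$, and $\bm{k}(w)=(k_1',\ldots,k_n')$ where \[k_j'=\begin{cases}k_j & j\le\alpha-1,\\ k_j-\bm{k}(\sigma)_1-\cdots-\bm{k}(\sigma)_\beta & j=\alpha,\\ k_j+\bm{k}(\sigma)_{j-\alpha} & j\in[\alpha+1,i_1],\\ k_j & j\ge i_1+1.\end{cases}\]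
   Context: $[m,n]=\{m,\ldots,n\}$, $[0]=\emptyset$. Rothe diagram $D(w)=\{(i,j)\in[n]^2: i<w^{ -1}(j),\ j<w(i)\}$ (row $i$, column $j$), columns $D(w)_j=\{i:(i,j)\in D(w)\}$. Standard interval: $[j]$, $j\ge0$. Dominant: all columns of $D(w)$ are standard intervals. Missing tooth of column $C$: $i\ge1$ with $i\notin C$, $i+1\in C$. Primary column data: if $w$ is not dominant, $h$ minimal with $D(w)_{h+1}$ not a standard interval, $C=D(w)_{h+1}$, $\alpha$ maximal with $[\alpha]\subseteq C$, $i_1$ the smallest missing tooth of $C$, $\beta=i_1-\alpha$; if $w$ dominant, $(h,C,\alpha,i_1,\beta)=(n,\emptyset,0,n,n)$. Then $w$ maps $[\alpha+1,i_1]$ bijectively onto $[h-\beta+1,h]$; $\sigma(w)\in S_\beta$, $\sigma(w)(p)=w(\alpha+p)-(h-\beta)$. $w_{\mathrm{sort}}$ is obtained from $w$ by reordering the values $w(\alpha+1),\ldots,w(i_1)$ increasingly. Orthodontic sequence of a permutation $u\in S_N$: start with $D=D(u)$. For $j\in[N]$ let $k_j$ be the number of columns equal to $[j]$; replace them by empty columns. If nonempty columns remain, let $i_1$ be the smallest missing tooth of the leftmost nonempty column and swap rows $i_1,i_1+1$; then $m_1$ is the number of columns equal to $[i_1]$, which are emptied; then $i_2$ is the smallest missing tooth of the leftmost nonempty column, rows $i_2,i_2+1$ are swapped, $m_2$ is the number of columns equal to $[i_2]$, etc., until no nonempty columns remain after $\ell$ swaps. $\bm{i}(u)=(i_1,\ldots,i_\ell)$,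 $\bm{k}(u)=(k_1,\ldots,k_N)$, $\bm{m}(u)=(m_1,\ldots,m_\ell)$. -}

module Defs where

open import Data.Nat using (ℕ; zero; suc; _+_; _∸_; _≤_; _<_; _≤ᵇ_; _<ᵇ_; _≡ᵇ_)
open import Data.Nat.Properties using (≤-decTotalOrder)
open import Data.Bool using (Bool; true; false; _∧_; not; _xor_; if_then_else_)
open import Data.List using (List; []; _∷_; map; upTo; take; drop; _++_; length)
open import Data.Bool.ListAction using (all; any)
open import Data.Nat.ListAction using (sum)
open import Data.List.Relation.Binary.Permutation.Propositional using (_↭_)
open import Data.Product using (_×_; ∃; Σ)
open import Relation.Binary.PropositionalEquality using (_≡_)
open import Relation.Nullary using (¬_)
open import Data.List.Sort ≤-decTotalOrder using (sort)

-- Permutations in one-line notation: w = [w(1), ..., w(n)], values in [1,n].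

range1 : ℕ → List ℕ
range1 N = map suc (upTo N)

IsPerm : ℕ → List ℕ → Set
IsPerm n w = w ↭ range1 n

-- 1-indexed lookup:  at xs i = xs(i)  (i ≥ 1); junk value 0 otherwise
at : List ℕ → ℕ → ℕ
at []       _             = 0
at (x ∷ xs) zero          = 0
at (x ∷ xs) (suc zero)    = x
at (x ∷ xs) (suc (suc i)) = at xs (suc i)

-- 1-indexed position of value j in w, i.e. w^{-1}(j) for a permutation
pos : List ℕ → ℕ → ℕ
pos []       j = 1
pos (x ∷ xs) j = if x ≡ᵇ j then 1 else suc (pos xs j)

-- Diagrams: Boolean functions on (row, column); only cells in [1,N]^2 count.

Diagram : Set
Diagram = ℕ → ℕ → Bool

rothe : ℕ → List ℕ → Diagram
rothe n w i j = (1 ≤ᵇ i) ∧ (i ≤ᵇ n) ∧ (1 ≤ᵇ j) ∧ (j ≤ᵇ n)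
                ∧ (i <ᵇ pos w j) ∧ (j <ᵇ at w i)

mem : ℕ → Diagram → ℕ → ℕ → Bool
mem N D r c = (1 ≤ᵇ r) ∧ (r ≤ᵇ N) ∧ (1 ≤ᵇ c) ∧ (c ≤ᵇ N) ∧ D r c

colIsᵇ : ℕ → Diagram → ℕ → ℕ → Bool
colIsᵇ N D c j = all (λ r → not (mem N D r c xor (r ≤ᵇ j))) (range1 N)

count : ℕ → Diagram → ℕ → ℕ
count N D j = sum (map (λ c → if colIsᵇ N D c j then 1 else 0) (range1 N))

clear : ℕ → Diagram → ℕ → Diagram
clear N D j r c = if colIsᵇ N D c j then false else D r c

clear0 : ℕ → Diagram → Diagram
clear0 N D r c = if any (λ j → colIsᵇ N D c j) (range1 N) then false else D r c

swapRow : ℕ → ℕ → ℕ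
swapRow i r = if r ≡ᵇ i then suc i else (if r ≡ᵇ suc i then i else r)

swapRows : ℕ → Diagram → Diagram
swapRows i D r c = D (swapRow i r) c

ColEmpty : ℕ → Diagram → ℕ → Set
ColEmpty N D c = ∀ r → mem N D r c ≡ false

Leftmost : ℕ → Diagram → ℕ → Set
Leftmost N D c = (1 ≤ c) × (c ≤ N) × (∃ λ r → mem N D r c ≡ true)
                 × (∀ c' → 1 ≤ c' → c' < c → ColEmpty N D c')

Tooth : ℕ → Diagram → ℕ → ℕ → Set
Tooth N D c i = (1 ≤ i) × (mem N D i c ≡ false) × (mem N D (suc i) c ≡ true)

SmallestTooth : ℕ → Diagram → ℕ → ℕ → Set
SmallestTooth N D c i = Tooth N D c i × (∀ i' → Tooth N D c i' → i ≤ i')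

-- The iterative part of the orthodontic process: Orth N D is ms holds iff
-- running the swap/empty loop from D produces i = is, m = ms.
data Orth (N : ℕ) : Diagram → List ℕ → List ℕ → Set where
  done : ∀ {D} → (∀ c → 1 ≤ c → c ≤ N → ColEmpty N D c) → Orth N D [] []
  step : ∀ {D c i is ms} → Leftmost N D c → SmallestTooth N D c i →
         Orth N (clear N (swapRows i D) i) is ms →
         Orth N D (i ∷ is) (count N (swapRows i D) i ∷ ms)

-- Orthodontic sequence of u ∈ S_N:  i(u) = is, k(u) = ks, m(u) = ms
OrthData : ℕ → List ℕ → List ℕ → List ℕ → List ℕ → Set
OrthData N u is ks ms =
  (ks ≡ map (count N (rothe N u)) (range1 N)) × Orth N (clear0 N (rothe N u)) is ms

InCol : ℕ → List ℕ → ℕ → ℕ → Set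
InCol n w c r = rothe n w r c ≡ true

StdCol : ℕ → List ℕ → ℕ → Set
StdCol n w c = ∃ λ j → ∀ r → (InCol n w c r → (1 ≤ r × r ≤ j)) × ((1 ≤ r × r ≤ j) → InCol n w c r)

Dominant : ℕ → List ℕ → Set
Dominant n w = ∀ c → 1 ≤ c → c ≤ n → StdCol n w c

PrefixIn : ℕ → List ℕ → ℕ → ℕ → Set
PrefixIn n w c a = ∀ r → 1 ≤ r → r ≤ a → InCol n w c r

MissingTooth : ℕ → List ℕ → ℕ → ℕ → Set
MissingTooth n w c i = (1 ≤ i) × ¬ InCol n w c i × InCol n w c (suc i)

-- (h, C = D(w)_{h+1}, α, i₁, β) is the primary column data of w
data PrimaryData (n : ℕ) (w : List ℕ) : ℕ → ℕ → ℕ → ℕ → Set where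
  dominant : Dominant n w → PrimaryData n w n 0 n n
  nonDominant : ∀ {h α i₁} →
    suc h ≤ n → ¬ StdCol n w (suc h) → (∀ c → 1 ≤ c → c ≤ h → StdCol n w c) →
    PrefixIn n w (suc h) α → (∀ a → PrefixIn n w (suc h) a → a ≤ α) →
    MissingTooth n w (suc h) i₁ → (∀ i → MissingTooth n w (suc h) i → i₁ ≤ i) →
    PrimaryData n w h α i₁ (i₁ ∸ α)

wsort : List ℕ → ℕ → ℕ → List ℕ
wsort w α i₁ = take α w ++ sort (take (i₁ ∸ α) (drop α w)) ++ drop i₁ w

sigma : List ℕ → ℕ → ℕ → ℕ → List ℕ
sigma w h α β = map (λ x → x ∸ (h ∸ β)) (take β (drop α w))

-- the formula for k'_j (for j ∈ [n]); the case j = α is written additively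
KPrime : ℕ → ℕ → List ℕ → List ℕ → List ℕ → ℕ → Set
KPrime α i₁ ks kσ ks' j =
    (j < α → at ks' j ≡ at ks j)
  × (j ≡ α → at ks' j + sum kσ ≡ at ks j)
  × (α < j → j ≤ i₁ → at ks' j ≡ at ks j + at kσ (j ∸ α))
  × (i₁ < j → at ks' j ≡ at ks j)

{-# OPTIONS --safe #-}
-- Write L = h − β. The primary column data force w to send the rows α+1, …, i₁ onto the values
-- L+1, …, h, the rows above them to values beyond h, and make the columns L+1, …, h of D(w) the
-- standard intervals [t] with α ≤ t < i₁; column L+p is [t] exactly when column p of D(σ) is [t − α].
-- Sorting the block leaves every other column of the diagram unchanged and turns these β columns
-- into [α]. So D(w) and D(w_sort) differ only in standard columns, which the first clearing step
-- empties: the swap/clear iteration, hence i and m, are the same for both. The k-vectors differ only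
-- in where the β middle columns are counted, which is what the formula records.
module Submission where

open import Defs
open import Data.Nat using (ℕ; _≤_)
open import Data.List using (List; length)
open import Data.Product using (_×_; ∃)
open import Relation.Binary.PropositionalEquality using (_≡_)

open import Data.Nat
open import Data.Nat.Properties
open import Data.Bool using (Bool; true; false; _∧_; not; _xor_; if_then_else_)
open import Data.Bool.Properties using (∧-zeroʳ; ∨-zeroʳ; if-eta; if-cong; if-cong-else)
open import Data.Bool.ListAction using (and; or; all; any)
open import Data.Fin using (Fin; toℕ; fromℕ<)
import Data.Fin.Properties as Fin
open import Data.List using ([]; _∷_; map; take; drop; _++_; applyUpTo)
open import Data.List.Properties
  using (map-upTo; map-cong; map-++; length-take; length-drop; length-map; take++drop≡id; drop-drop)
open import Data.Nat.ListAction using (sum)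
open import Data.Nat.ListAction.Properties using (sum-++)
open import Data.List.Membership.Propositional using (_∈_)
import Data.List.Relation.Unary.All as All
open import Data.List.Relation.Unary.Any using (here; there)
open import Data.List.Relation.Unary.AllPairs using ([]; _∷_)
open import Data.List.Relation.Unary.Unique.Propositional using (Unique)
open import Data.List.Relation.Unary.Linked using (Linked; _∷_)
open import Data.List.Relation.Binary.Permutation.Propositional using (_↭_; ↭-sym; ↭-trans; ↭⇒↭ₛ)
open import Data.List.Relation.Binary.Permutation.Propositional.Properties using (∈-resp-↭; ↭-length; ++⁺ˡ; ++⁺ʳ)
import Data.List.Relation.Binary.Permutation.Setoid.Properties as Setoid↭
open import Data.List.Sort ≤-decTotalOrder using (sort; sort-↭; sort-↗)
open import Data.Product using (Σ; _,_; proj₁; proj₂)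
open import Data.Sum using (_⊎_; inj₁; inj₂; [_,_]′)
open import Relation.Binary.PropositionalEquality
open import Relation.Nullary using (Dec; does; yes; no; ¬_; contradiction; _×-dec_)
open import Relation.Nullary.Decidable using (dec-true; dec-false)
open import Function using (_∘_)
open import Relation.Binary.Definitions using (tri<; tri≈; tri>)
open import Algebra.Properties.CommutativeSemigroup +-commutativeSemigroup using (interchange; xy∙z≈xz∙y)

-- For ℕ, does (m ≤? n), does (m <? n) and does (m ≟ n) reduce to m ≤ᵇ n, m <ᵇ n and m ≡ᵇ n, so
-- dec-true, dec-false and dec-true⁻¹ translate between these Boolean tests and the relations.
dec-true⁻¹ : ∀ {P : Set} (p? : Dec P) → does p? ≡ true → P
dec-true⁻¹ (yes p) _ = p

𝟙 : Bool → ℕ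
𝟙 b = if b then 1 else 0

all-true : ∀ {A : Set} (p : A → Bool) xs → (∀ {x} → x ∈ xs → p x ≡ true) → all p xs ≡ true
all-true p []       _ = refl
all-true p (x ∷ xs) h rewrite h (here refl) = all-true p xs (h ∘ there)

all-false : ∀ {A : Set} (p : A → Bool) {x xs} → x ∈ xs → p x ≡ false → all p xs ≡ false
all-false p (here refl) px≡false rewrite px≡false = refl
all-false p {xs = y ∷ _} (there x∈) px≡false rewrite all-false p x∈ px≡false = ∧-zeroʳ (p y)

any-true : ∀ {A : Set} (p : A → Bool) {x xs} → x ∈ xs → p x ≡ true → any p xs ≡ true
any-true p (here refl) px≡true rewrite px≡true = refl
any-true p {xs = y ∷ _} (there x∈) px≡true rewrite any-true p x∈ px≡true = ∨-zeroʳ (p y)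

InBox : ℕ → ℕ → Set
InBox N x = 1 ≤ x × x ≤ N

interval : ℕ → ℕ → List ℕ
interval a zero    = []
interval a (suc k) = a ∷ interval (suc a) k

applyUpTo≡interval : ∀ a k (f : ℕ → ℕ) → (∀ x → f x ≡ a + x) → applyUpTo f k ≡ interval a k
applyUpTo≡interval a zero    f f≗ = refl
applyUpTo≡interval a (suc k) f f≗ =
  cong₂ _∷_ (trans (f≗ 0) (+-identityʳ a))
            (applyUpTo≡interval (suc a) k (f ∘ suc) (λ x → trans (f≗ (suc x)) (+-suc a x)))

range1≡interval : ∀ N → range1 N ≡ interval 1 N
range1≡interval N = trans (map-upTo suc N) (applyUpTo≡interval 1 N suc (λ _ → refl))

length-interval : ∀ a k → length (interval a k) ≡ k
length-interval a zero    = refl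
length-interval a (suc k) = cong suc (length-interval (suc a) k)

∈-interval⁻ : ∀ {x} a k → x ∈ interval a k → a ≤ x × x < a + k
∈-interval⁻ a (suc k) (here refl) = ≤-refl , m<m+n a z<s
∈-interval⁻ {x} a (suc k) (there x∈) =
  let a<x , x<a+1+k = ∈-interval⁻ (suc a) k x∈ in <⇒≤ a<x , subst (x <_) (sym (+-suc a k)) x<a+1+k

∈-interval⁺ : ∀ {x} a k → a ≤ x → x < a + k → x ∈ interval a k
∈-interval⁺ {x} a zero    a≤x x<a+0 = contradiction (≤-trans x<a+0 (≤-reflexive (+-identityʳ a))) (≤⇒≯ a≤x)
∈-interval⁺ {x} a (suc k) a≤x x<a+k with a ≟ x
... | yes refl = here refl
... | no  a≢x  = there (∈-interval⁺ (suc a) k (≤∧≢⇒< a≤x a≢x) (subst (x <_) (+-suc a k) x<a+k))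

interval-++ : ∀ a k l → interval a (k + l) ≡ interval a k ++ interval (a + k) l
interval-++ a zero    l = cong (λ b → interval b l) (sym (+-identityʳ a))
interval-++ a (suc k) l =
  cong (a ∷_) (trans (interval-++ (suc a) k l) (cong (λ b → interval (suc a) k ++ interval b l) (sym (+-suc a k))))

interval-unique : ∀ a k → Unique (interval a k)
interval-unique a zero    = []
interval-unique a (suc k) =
  All.tabulate (λ x∈ → <⇒≢ (proj₁ (∈-interval⁻ (suc a) k x∈))) ∷ interval-unique (suc a) k

∑ : (ℕ → ℕ) → ℕ → ℕ → ℕ
∑ F a k = sum (map F (interval a k))

∑-cong : ∀ {F G} a k → (∀ x → a ≤ x → x < a + k → F x ≡ G x) → ∑ F a k ≡ ∑ G a k
∑-cong a zero    F≗G = refl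
∑-cong a (suc k) F≗G =
  cong₂ _+_ (F≗G a ≤-refl (m<m+n a z<s))
            (∑-cong (suc a) k (λ x a<x x<a+1+k → F≗G x (<⇒≤ a<x) (subst (x <_) (sym (+-suc a k)) x<a+1+k)))

∑-split : ∀ F a k l → ∑ F a (k + l) ≡ ∑ F a k + ∑ F (a + k) l
∑-split F a k l = begin
  sum (map F (interval a (k + l)))                       ≡⟨ cong (sum ∘ map F) (interval-++ a k l) ⟩
  sum (map F (interval a k ++ interval (a + k) l))       ≡⟨ cong sum (map-++ F (interval a k) _) ⟩
  sum (map F (interval a k) ++ map F (interval (a + k) l)) ≡⟨ sum-++ (map F (interval a k)) _ ⟩
  ∑ F a k + ∑ F (a + k) l                                ∎
  where open ≡-Reasoning

∑-+ : ∀ F G a k → ∑ (λ x → F x + G x) a k ≡ ∑ F a k + ∑ G a k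
∑-+ F G a zero    = refl
∑-+ F G a (suc k) = trans (cong (F a + G a +_) (∑-+ F G (suc a) k)) (interchange (F a) (G a) _ _)

∑-shift : ∀ F d a k → ∑ F (d + a) k ≡ ∑ (λ x → F (d + x)) a k
∑-shift F d a zero    = refl
∑-shift F d a (suc k) = cong (F (d + a) +_) (trans (cong (λ b → ∑ F b k) (sym (+-suc d a))) (∑-shift F d (suc a) k))

∑-const : ∀ c a k → ∑ (λ _ → c) a k ≡ k * c
∑-const c a zero    = refl
∑-const c a (suc k) = cong (c +_) (∑-const c (suc a) k)

∑-≡const : ∀ {F} c a k → (∀ x → a ≤ x → x < a + k → F x ≡ c) → ∑ F a k ≡ k * c
∑-≡const c a k F≡c = trans (∑-cong a k F≡c) (∑-const c a k)

∑-comm : ∀ (G : ℕ → ℕ → ℕ) a k b l →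
         ∑ (λ x → ∑ (G x) b l) a k ≡ ∑ (λ y → ∑ (λ x → G x y) a k) b l
∑-comm G a zero    b l = sym (trans (∑-const 0 b l) (*-zeroʳ l))
∑-comm G a (suc k) b l = trans (cong (∑ (G a) b l +_) (∑-comm G (suc a) k b l))
                               (sym (∑-+ (G a) (λ y → ∑ (λ x → G x y) (suc a) k) b l))

∑-indicator : ∀ t a k → a ≤ t → t < a + k → ∑ (λ x → 𝟙 (x ≡ᵇ t)) a k ≡ 1
∑-indicator t a zero    a≤t t<a+0 = contradiction (≤-trans t<a+0 (≤-reflexive (+-identityʳ a))) (≤⇒≯ a≤t)
∑-indicator t a (suc k) a≤t t<a+k with a ≟ t
... | yes refl = cong₂ _+_ (cong 𝟙 (dec-true (a ≟ a) refl))
                           (trans (∑-≡const 0 (suc a) k λ x a<x _ → cong 𝟙 (dec-false (x ≟ a) (>⇒≢ a<x)))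
                                  (*-zeroʳ k))
... | no  a≢t  = trans (cong₂ _+_ (cong 𝟙 (dec-false (a ≟ t) a≢t)) refl)
                         (∑-indicator t (suc a) k (≤∧≢⇒< a≤t a≢t) (subst (t <_) (+-suc a k) t<a+k))

at-map : ∀ (F : ℕ → ℕ) xs p → p < length xs → at (map F xs) (suc p) ≡ F (at xs (suc p))
at-map F (x ∷ xs) zero    _         = refl
at-map F (x ∷ xs) (suc p) (s≤s p<) = at-map F xs p p<

at-++ˡ : ∀ (xs ys : List ℕ) p → p < length xs → at (xs ++ ys) (suc p) ≡ at xs (suc p)
at-++ˡ (x ∷ xs) ys zero    _         = refl
at-++ˡ (x ∷ xs) ys (suc p) (s≤s p<) = at-++ˡ xs ys p p<

at-++ʳ : ∀ (xs ys : List ℕ) p → at (xs ++ ys) (suc (length xs + p)) ≡ at ys (suc p)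
at-++ʳ []       ys p = refl
at-++ʳ (x ∷ xs) ys p = at-++ʳ xs ys p

at-interval : ∀ a k p → p < k → at (interval a k) (suc p) ≡ a + p
at-interval a (suc k) zero    _         = sym (+-identityʳ a)
at-interval a (suc k) (suc p) (s≤s p<k) = trans (at-interval (suc a) k p p<k) (sym (+-suc a p))

at-map-range1 : ∀ (F : ℕ → ℕ) N j → InBox N j → at (map F (range1 N)) j ≡ F j
at-map-range1 F N (suc p) (_ , 1+p≤N) rewrite range1≡interval N =
  trans (at-map F (interval 1 N) p (subst (p <_) (sym (length-interval 1 N)) 1+p≤N)) (cong F (at-interval 1 N p 1+p≤N))

length-range1 : ∀ N → length (range1 N) ≡ N
length-range1 N = trans (cong length (range1≡interval N)) (length-interval 1 N)

at-∈ : ∀ (xs : List ℕ) p → p < length xs → at xs (suc p) ∈ xs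
at-∈ (x ∷ xs) zero    _         = here refl
at-∈ (x ∷ xs) (suc p) (s≤s p<) = there (at-∈ xs p p<)

∈⇒at : ∀ {x} (xs : List ℕ) → x ∈ xs → Σ ℕ λ p → p < length xs × at xs (suc p) ≡ x
∈⇒at (y ∷ xs) (here refl) = 0 , s≤s z≤n , refl
∈⇒at (y ∷ xs) (there x∈)  = let p , p< , eq = ∈⇒at xs x∈ in suc p , s≤s p< , eq

pos-at-first : ∀ xs p → p < length xs → (∀ q → q < p → at xs (suc q) ≢ at xs (suc p)) →
               pos xs (at xs (suc p)) ≡ suc p
pos-at-first (x ∷ xs) zero    _         _     rewrite dec-true (x ≟ x) refl = refl
pos-at-first (x ∷ xs) (suc p) (s≤s p<) first rewrite dec-false (x ≟ at xs (suc p)) (first 0 z<s) =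
  cong suc (pos-at-first xs p p< (λ q q<p → first (suc q) (s≤s q<p)))

Unique-at-injective : ∀ {xs} → Unique xs → ∀ p q → p < length xs → q < length xs →
                      at xs (suc p) ≡ at xs (suc q) → p ≡ q
Unique-at-injective           _        zero    zero    _         _         _  = refl
Unique-at-injective {_ ∷ xs} (x∉ ∷ _) zero    (suc q) _         (s≤s q<) eq = contradiction eq (All.lookup x∉ (at-∈ xs q q<))
Unique-at-injective {_ ∷ xs} (x∉ ∷ _) (suc p) zero    (s≤s p<) _         eq =
  contradiction (sym eq) (All.lookup x∉ (at-∈ xs p p<))
Unique-at-injective          (_ ∷ u)  (suc p) (suc q) (s≤s p<) (s≤s q<) eq = cong suc (Unique-at-injective u p q p< q< eq)

Unique-pos-at : ∀ {xs} → Unique xs → ∀ p → p < length xs → pos xs (at xs (suc p)) ≡ suc p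
Unique-pos-at {xs} u p p< = pos-at-first xs p p< (λ q q<p eq → <⇒≢ q<p (Unique-at-injective u q p (<-trans q<p p<) p< eq))

Linked-at-mono : ∀ {xs} → Linked _≤_ xs → ∀ {p q} → p ≤ q → q < length xs → at xs (suc p) ≤ at xs (suc q)
Linked-at-mono {x ∷ xs}     _         {zero}  {zero}  _         _         = ≤-refl
Linked-at-mono {x ∷ y ∷ xs} (x≤y ∷ l) {zero}  {suc q} _         (s≤s q<) = ≤-trans x≤y (Linked-at-mono l z≤n q<)
Linked-at-mono {x ∷ y ∷ xs} (_ ∷ l)   {suc p} {suc q} (s≤s p≤q) (s≤s q<) = Linked-at-mono l p≤q q<
Linked-at-mono {x ∷ []}     _         {_}     {suc q} _         (s≤s ())

at-zero : ∀ xs → at xs 0 ≡ 0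
at-zero []       = refl
at-zero (x ∷ xs) = refl

at-++-beyond : ∀ (Y Y' Z : List ℕ) r → length Y ≡ length Y' → length Y < r → at (Y ++ Z) r ≡ at (Y' ++ Z) r
at-++-beyond []      []        Z r             _  _         = refl
at-++-beyond (_ ∷ Y) (_ ∷ Y')  Z (suc (suc r)) eq (s≤s Y<r) = at-++-beyond Y Y' Z (suc r) (suc-injective eq) Y<r
at-++-beyond (_ ∷ Y) (_ ∷ Y')  Z (suc zero)    _  (s≤s ())

at-++-++-outside : ∀ (X Y Y' Z : List ℕ) r → length Y ≡ length Y' → r ≤ length X ⊎ length X + length Y < r →
                   at (X ++ Y ++ Z) r ≡ at (X ++ Y' ++ Z) r
at-++-++-outside []      Y Y' Z zero          _  _             = trans (at-zero (Y ++ Z)) (sym (at-zero (Y' ++ Z)))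
at-++-++-outside []      Y Y' Z (suc r)       _  (inj₁ ())
at-++-++-outside []      Y Y' Z (suc r)       eq (inj₂ Y<r)    = at-++-beyond Y Y' Z (suc r) eq Y<r
at-++-++-outside (_ ∷ X) Y Y' Z zero          _  _             = refl
at-++-++-outside (_ ∷ X) Y Y' Z (suc zero)    _  _             = refl
at-++-++-outside (_ ∷ X) Y Y' Z (suc (suc r)) eq (inj₁ (s≤s r≤)) = at-++-++-outside X Y Y' Z (suc r) eq (inj₁ r≤)
at-++-++-outside (_ ∷ X) Y Y' Z (suc (suc r)) eq (inj₂ (s≤s <r)) = at-++-++-outside X Y Y' Z (suc r) eq (inj₂ <r)

at-++-++-inside : ∀ (X Y Z : List ℕ) q → q < length Y → at (X ++ Y ++ Z) (suc (length X + q)) ≡ at Y (suc q)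
at-++-++-inside X Y Z q q< = trans (at-++ʳ X (Y ++ Z) q) (at-++ˡ Y Z q q<)

Unique-resp-↭ : ∀ {xs ys : List ℕ} → xs ↭ ys → Unique xs → Unique ys
Unique-resp-↭ p = Setoid↭.Unique-resp-↭ (setoid ℕ) (↭⇒↭ₛ p)

record Perm (n : ℕ) (u : List ℕ) : Set where
  field
    length≡  : length u ≡ n
    at-range  : ∀ r → 1 ≤ r → r ≤ n → 1 ≤ at u r × at u r ≤ n
    pos-range : ∀ c → 1 ≤ c → c ≤ n → 1 ≤ pos u c × pos u c ≤ n
    pos-at    : ∀ r → 1 ≤ r → r ≤ n → pos u (at u r) ≡ r
    at-pos    : ∀ c → 1 ≤ c → c ≤ n → at u (pos u c) ≡ c

  at-injective : ∀ r r' → 1 ≤ r → r ≤ n → 1 ≤ r' → r' ≤ n → at u r ≡ at u r' → r ≡ r'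
  at-injective r r' 1≤r r≤n 1≤r' r'≤n eq =
    trans (sym (pos-at r 1≤r r≤n)) (trans (cong (pos u) eq) (pos-at r' 1≤r' r'≤n))

isPerm⇒Perm : ∀ {n u} → IsPerm n u → Perm n u
isPerm⇒Perm {n} {u} u↭ = record
  { length≡ = length≡ ; at-range = at-range ; pos-range = pos-range ; pos-at = pos-at ; at-pos = at-pos }
  where
  u↭[1,n] : u ↭ interval 1 n
  u↭[1,n] = subst (u ↭_) (range1≡interval n) u↭
  length≡ : length u ≡ n
  length≡ = trans (↭-length u↭[1,n]) (length-interval 1 n)
  unique : Unique u
  unique = Unique-resp-↭ (↭-sym u↭[1,n]) (interval-unique 1 n)
  at-range : ∀ r → 1 ≤ r → r ≤ n → 1 ≤ at u r × at u r ≤ n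
  at-range (suc p) _ r≤n =
    let 1≤ , <1+n = ∈-interval⁻ 1 n (∈-resp-↭ u↭[1,n] (at-∈ u p (subst (p <_) (sym length≡) r≤n)))
    in 1≤ , ≤-pred <1+n
  pos-at : ∀ r → 1 ≤ r → r ≤ n → pos u (at u r) ≡ r
  pos-at (suc p) _ r≤n = Unique-pos-at unique p (subst (p <_) (sym length≡) r≤n)
  preimage : ∀ c → 1 ≤ c → c ≤ n → Σ ℕ λ p → p < n × at u (suc p) ≡ c
  preimage c 1≤c c≤n =
    let p , p< , eq = ∈⇒at u (∈-resp-↭ (↭-sym u↭[1,n]) (∈-interval⁺ 1 n 1≤c (s≤s c≤n)))
    in p , subst (p <_) length≡ p< , eq
  pos-range : ∀ c → 1 ≤ c → c ≤ n → 1 ≤ pos u c × pos u c ≤ n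
  pos-range c 1≤c c≤n with preimage c 1≤c c≤n
  ... | p , p<n , refl rewrite pos-at (suc p) z<s p<n = z<s , p<n
  at-pos : ∀ c → 1 ≤ c → c ≤ n → at u (pos u c) ≡ c
  at-pos c 1≤c c≤n with preimage c 1≤c c≤n
  ... | p , p<n , refl rewrite pos-at (suc p) z<s p<n = refl

injective-on⇒≤ : ∀ {k m} (F : ℕ → ℕ) → (∀ x → x < k → F x < m) →
                 (∀ x y → x < k → y < k → F x ≡ F y → x ≡ y) → k ≤ m
injective-on⇒≤ {k} {m} F F< F-inj = Fin.injective⇒≤ f-injective
  where
  f : Fin k → Fin m
  f i = fromℕ< (F< (toℕ i) (Fin.toℕ<n i))
  f-injective : ∀ {i j} → f i ≡ f j → i ≡ j
  f-injective {i} {j} eq = Fin.toℕ-injective (F-inj _ _ (Fin.toℕ<n i) (Fin.toℕ<n j) (begin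
    F (toℕ i)    ≡⟨ Fin.toℕ-fromℕ< _ ⟨
    toℕ (f i)    ≡⟨ cong toℕ eq ⟩
    toℕ (f j)    ≡⟨ Fin.toℕ-fromℕ< _ ⟩
    F (toℕ j)    ∎))
    where open ≡-Reasoning

mem-inside : ∀ N D {r c} → InBox N r → InBox N c → mem N D r c ≡ D r c
mem-inside N D {r} {c} (1≤r , r≤N) (1≤c , c≤N)
  rewrite dec-true (1 ≤? r) 1≤r | dec-true (r ≤? N) r≤N | dec-true (1 ≤? c) 1≤c | dec-true (c ≤? N) c≤N = refl

mem-outside-row : ∀ N D {r} c → ¬ InBox N r → mem N D r c ≡ false
mem-outside-row N D {r} c out with 1 ≤? r | r ≤? N
... | no ¬1≤r | _       rewrite dec-false (1 ≤? r) ¬1≤r = refl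
... | yes 1≤r | no ¬r≤N rewrite dec-true (1 ≤? r) 1≤r | dec-false (r ≤? N) ¬r≤N = refl
... | yes 1≤r | yes r≤N = contradiction (1≤r , r≤N) out

mem-outside-col : ∀ N D r {c} → ¬ InBox N c → mem N D r c ≡ false
mem-outside-col N D r {c} out =
  trans (cong (λ b → (1 ≤ᵇ r) ∧ (r ≤ᵇ N) ∧ b) column-part) (row-part (1 ≤ᵇ r) (r ≤ᵇ N))
  where
  row-part : ∀ a b → a ∧ b ∧ false ≡ false
  row-part a b = trans (cong (a ∧_) (∧-zeroʳ b)) (∧-zeroʳ a)
  column-part : (1 ≤ᵇ c) ∧ (c ≤ᵇ N) ∧ D r c ≡ false
  column-part with 1 ≤? c | c ≤? N
  ... | no ¬1≤c | _       rewrite dec-false (1 ≤? c) ¬1≤c = refl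
  ... | yes 1≤c | no ¬c≤N rewrite dec-true (1 ≤? c) 1≤c | dec-false (c ≤? N) ¬c≤N = refl
  ... | yes 1≤c | yes c≤N = contradiction (1≤c , c≤N) out

inBox? : ∀ N x → Dec (InBox N x)
inBox? N x = (1 ≤? x) ×-dec (x ≤? N)

mem-idem : ∀ N D r c → mem N (mem N D) r c ≡ mem N D r c
mem-idem N D r c with inBox? N r | inBox? N c
... | yes r∈ | yes c∈ = mem-inside N (mem N D) r∈ c∈
... | no  r∉ | _      = trans (mem-outside-row N (mem N D) c r∉) (sym (mem-outside-row N D c r∉))
... | yes _  | no c∉  = trans (mem-outside-col N (mem N D) r c∉) (sym (mem-outside-col N D r c∉))

-- rothe N u is definitionally mem N (inversion u).
inversion : List ℕ → Diagram
inversion u r c = (r <ᵇ pos u c) ∧ (c <ᵇ at u r)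

∧≡true⁻ : ∀ {a b} → a ∧ b ≡ true → a ≡ true × b ≡ true
∧≡true⁻ {true} {true} _ = refl , refl

InCol⁻ : ∀ n u c r → InCol n u c r → InBox n r × InBox n c × r < pos u c × c < at u r
InCol⁻ n u c r r∈C with inBox? n r | inBox? n c
... | no r∉ | _     = contradiction (trans (sym (mem-outside-row n (inversion u) c r∉)) r∈C) λ ()
... | yes _ | no c∉ = contradiction (trans (sym (mem-outside-col n (inversion u) r c∉)) r∈C) λ ()
... | yes r∈ | yes c∈ =
  let r<pos , c<at = ∧≡true⁻ (trans (sym (mem-inside n (inversion u) r∈ c∈)) r∈C)
  in r∈ , c∈ , dec-true⁻¹ (r <? pos u c) r<pos , dec-true⁻¹ (c <? at u r) c<at

InCol⇒<pos : ∀ n u c r → InCol n u c r → r < pos u c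
InCol⇒<pos n u c r r∈C = proj₁ (proj₂ (proj₂ (InCol⁻ n u c r r∈C)))

InCol⇒<at : ∀ n u c r → InCol n u c r → c < at u r
InCol⇒<at n u c r r∈C = proj₂ (proj₂ (proj₂ (InCol⁻ n u c r r∈C)))

InCol⁺ : ∀ n u c r → InBox n r → InBox n c → r < pos u c → c < at u r → InCol n u c r
InCol⁺ n u c r r∈ c∈ r<pos c<at =
  trans (mem-inside n (inversion u) r∈ c∈) (cong₂ _∧_ (dec-true (r <? pos u c) r<pos) (dec-true (c <? at u r) c<at))

∈-range1⁻ : ∀ {N x} → x ∈ range1 N → InBox N x
∈-range1⁻ {N} x∈ =
  let 1≤x , x<1+N = ∈-interval⁻ 1 N (subst (_ ∈_) (range1≡interval N) x∈) in 1≤x , ≤-pred x<1+N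

∈-range1⁺ : ∀ {N x} → InBox N x → x ∈ range1 N
∈-range1⁺ {N} (1≤x , x≤N) = subst (_ ∈_) (sym (range1≡interval N)) (∈-interval⁺ 1 N 1≤x (s≤s x≤N))

StandardColumn : ℕ → Diagram → ℕ → ℕ → Set
StandardColumn N D c t = ∀ r → InBox N r → mem N D r c ≡ (r ≤ᵇ t)

not-xor-self : ∀ b → not (b xor b) ≡ true
not-xor-self true  = refl
not-xor-self false = refl

not-xor-true-false : ∀ {a b} → a ≡ true → b ≡ false → not (a xor b) ≡ false
not-xor-true-false refl refl = refl

not-xor-false-true : ∀ {a b} → a ≡ false → b ≡ true → not (a xor b) ≡ false
not-xor-false-true refl refl = refl

colIsᵇ-standard : ∀ N D c {t j} → StandardColumn N D c t → t ≤ N → j ≤ N → colIsᵇ N D c j ≡ (j ≡ᵇ t)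
colIsᵇ-standard N D c {t} {j} std t≤N j≤N with <-cmp j t
... | tri≈ _ refl _ rewrite dec-true (j ≟ j) refl =
  all-true _ (range1 N) λ {r} r∈ →
    trans (cong (λ b → not (b xor (r ≤ᵇ j))) (std r (∈-range1⁻ r∈))) (not-xor-self (r ≤ᵇ j))
... | tri< j<t _ _ rewrite dec-false (j ≟ t) (<⇒≢ j<t) =
  all-false _ (∈-range1⁺ t∈)
    (not-xor-true-false (trans (std t t∈) (dec-true (t ≤? t) ≤-refl)) (dec-false (t ≤? j) (<⇒≱ j<t)))
  where t∈ = ≤-trans z<s j<t , t≤N
... | tri> _ _ t<j rewrite dec-false (j ≟ t) (>⇒≢ t<j) =
  all-false _ (∈-range1⁺ j∈)
    (not-xor-false-true (trans (std j j∈) (dec-false (j ≤? t) (<⇒≱ t<j))) (dec-true (j ≤? j) ≤-refl))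
  where j∈ = ≤-trans z<s t<j , j≤N

clear0-false : ∀ N D r c → D r c ≡ false → clear0 N D r c ≡ false
clear0-false N D r c Drc≡false = trans (if-cong-else anyStd Drc≡false) (if-eta anyStd)
  where anyStd = any (λ j → colIsᵇ N D c j) (range1 N)

clear0-standard : ∀ N D c {t} → StandardColumn N D c t → t ≤ N → (∀ r → D r c ≡ mem N D r c) →
                  ∀ r → clear0 N D r c ≡ false
clear0-standard N D c {zero} std _ supported r = clear0-false N D r c (trans (supported r) mem≡false)
  where
  mem≡false : mem N D r c ≡ false
  mem≡false with inBox? N r
  ... | yes r∈@(1≤r , _) = trans (std r r∈) (dec-false (r ≤? 0) (<⇒≱ 1≤r))
  ... | no  r∉           = mem-outside-row N D c r∉
clear0-standard N D c {suc t} std t≤N _ r =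
  if-cong (any-true (λ j → colIsᵇ N D c j) (∈-range1⁺ (z<s , t≤N))
                    (trans (colIsᵇ-standard N D c std t≤N t≤N) (dec-true (suc t ≟ suc t) refl)))

mem-cong : ∀ N D D' {r c} → D r c ≡ D' r c → mem N D r c ≡ mem N D' r c
mem-cong N _ _ {r} {c} = cong (λ b → (1 ≤ᵇ r) ∧ (r ≤ᵇ N) ∧ (1 ≤ᵇ c) ∧ (c ≤ᵇ N) ∧ b)

colIsᵇ-cong : ∀ N D D' c → (∀ r → D r c ≡ D' r c) → ∀ j → colIsᵇ N D c j ≡ colIsᵇ N D' c j
colIsᵇ-cong N D D' c Dc≗D'c j =
  cong and (map-cong (λ r → cong (λ b → not (b xor (r ≤ᵇ j))) (mem-cong N D D' (Dc≗D'c r))) (range1 N))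

clear0-cong : ∀ N D D' c → (∀ r → D r c ≡ D' r c) → ∀ r → clear0 N D r c ≡ clear0 N D' r c
clear0-cong N D D' c Dc≗D'c r =
  trans (if-cong (cong or (map-cong (colIsᵇ-cong N D D' c Dc≗D'c) (range1 N))))
        (if-cong-else (any (λ j → colIsᵇ N D' c j) (range1 N)) (Dc≗D'c r))

infix 4 _≐_
_≐_ : Diagram → Diagram → Set
D ≐ D' = ∀ r c → D r c ≡ D' r c

≐-sym : ∀ {D D'} → D ≐ D' → D' ≐ D
≐-sym D≐D' r c = sym (D≐D' r c)

count-cong : ∀ N {D D'} → D ≐ D' → ∀ j → count N D j ≡ count N D' j
count-cong N {D} {D'} D≐D' j =
  cong sum (map-cong (λ c → cong 𝟙 (colIsᵇ-cong N D D' c (λ r → D≐D' r c) j)) (range1 N))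

clear-cong : ∀ N {D D'} → D ≐ D' → ∀ j → clear N D j ≐ clear N D' j
clear-cong N {D} {D'} D≐D' j r c =
  trans (if-cong (colIsᵇ-cong N D D' c (λ r → D≐D' r c) j)) (if-cong-else (colIsᵇ N D' c j) (D≐D' r c))

swapRows-cong : ∀ i {D D'} → D ≐ D' → swapRows i D ≐ swapRows i D'
swapRows-cong i D≐D' r c = D≐D' (swapRow i r) c

module _ {N : ℕ} {D D' : Diagram} (D≐D' : D ≐ D') where

  private
    mem≡ : ∀ r c → mem N D r c ≡ mem N D' r c
    mem≡ r c = mem-cong N D D' (D≐D' r c)

  ColEmpty-resp-≐ : ∀ {c} → ColEmpty N D c → ColEmpty N D' c
  ColEmpty-resp-≐ {c} empty r = trans (sym (mem≡ r c)) (empty r)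

  Leftmost-resp-≐ : ∀ {c} → Leftmost N D c → Leftmost N D' c
  Leftmost-resp-≐ {c} (1≤c , c≤N , (r , r∈) , leftmost) =
    1≤c , c≤N , (r , trans (sym (mem≡ r c)) r∈) , λ c' 1≤c' c'<c → ColEmpty-resp-≐ {c'} (leftmost c' 1≤c' c'<c)

  Tooth-resp-≐ : ∀ {c i} → Tooth N D c i → Tooth N D' c i
  Tooth-resp-≐ {c} {i} (1≤i , i∉ , 1+i∈) = 1≤i , trans (sym (mem≡ i c)) i∉ , trans (sym (mem≡ (suc i) c)) 1+i∈

Orth-resp-≐ : ∀ {N D D' is ms} → D ≐ D' → Orth N D is ms → Orth N D' is ms
Orth-resp-≐ {N} D≐D' (done empty) = done (λ c 1≤c c≤N → ColEmpty-resp-≐ {N} D≐D' {c} (empty c 1≤c c≤N))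
Orth-resp-≐ {N} {D' = D'} D≐D' (step {c = c} {i = i} {is} {ms} leftmost (tooth , smallest) rest) =
  subst (λ m → Orth N D' (i ∷ is) (m ∷ ms)) (count-cong N (swapRows-cong i (≐-sym D≐D')) i)
    (step (Leftmost-resp-≐ {N} D≐D' {c} leftmost)
          (Tooth-resp-≐ {N} D≐D' {c} tooth , λ i' tooth' → smallest i' (Tooth-resp-≐ {N} (≐-sym D≐D') {c} tooth'))
          (Orth-resp-≐ (clear-cong N (swapRows-cong i D≐D') i) rest))

count≡∑ : ∀ N D j → count N D j ≡ ∑ (λ c → 𝟙 (colIsᵇ N D c j)) 1 N
count≡∑ N D j = cong (sum ∘ map (λ c → 𝟙 (colIsᵇ N D c j))) (range1≡interval N)

≡true⇔⇒≡ : ∀ {a b} → (a ≡ true → b ≡ true) → (b ≡ true → a ≡ true) → a ≡ b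
≡true⇔⇒≡ {true}  {true}  _ _ = refl
≡true⇔⇒≡ {true}  {false} f _ = sym (f refl)
≡true⇔⇒≡ {false} {true}  _ g = g refl
≡true⇔⇒≡ {false} {false} _ _ = refl

StdCol⇒StandardColumn : ∀ {n u c} → (std : StdCol n u c) → StandardColumn n (rothe n u) c (proj₁ std)
StdCol⇒StandardColumn {n} {u} {c} (t , column≡[t]) r r∈@(1≤r , _) =
  trans (mem-idem n (inversion u) r c)
        (≡true⇔⇒≡ (λ r∈C → dec-true (r ≤? t) (proj₂ (proj₁ (column≡[t] r) r∈C)))
                  (λ r≤t → proj₂ (column≡[t] r) (1≤r , dec-true⁻¹ (r ≤? t) r≤t)))

∸-suc-< : ∀ k x m → k < x → x ≤ k + m → x ∸ suc k < m
∸-suc-< zero    (suc x) m _         x≤m   = x≤m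
∸-suc-< (suc k) (suc x) m (s≤s k<x) (s≤s x≤) = ∸-suc-< k x m k<x x≤

offset-in-block : ∀ {α β i₁} → α + β ≡ i₁ → ∀ q → q < β → α < suc (α + q) × suc (α + q) ≤ i₁
offset-in-block {α} α+β≡i₁ q q<β = s≤s (m≤m+n α q) , subst (suc α + q ≤_) α+β≡i₁ (+-monoʳ-< α q<β)

record Block (n : ℕ) (w : List ℕ) (h α i₁ β : ℕ) : Set where
  field
    L            : ℕ
    L+β≡h        : L + β ≡ h
    α+β≡i₁       : α + β ≡ i₁
    i₁≤n         : i₁ ≤ n
    h≤n          : h ≤ n
    prefix-above : ∀ r → 1 ≤ r → r ≤ α → h < at w r
    block-into   : ∀ r → α < r → r ≤ i₁ → L < at w r × at w r ≤ h
    block-onto   : ∀ c → L < c → c ≤ h → α < pos w c × pos w c ≤ i₁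
    block-std    : ∀ c → L < c → c ≤ h → StdCol n w c

dominant⇒Block : ∀ {n w} → Perm n w → Dominant n w → Block n w n 0 n n
dominant⇒Block P dom = record
  { L = 0 ; L+β≡h = refl ; α+β≡i₁ = refl ; i₁≤n = ≤-refl ; h≤n = ≤-refl
  ; prefix-above = λ r 1≤r r≤0 → contradiction (≤-trans 1≤r r≤0) λ ()
  ; block-into   = Perm.at-range P
  ; block-onto   = Perm.pos-range P
  ; block-std    = dom }

module NonDominant {n : ℕ} {w : List ℕ} (P : Perm n w) {h α i₁ : ℕ}
  (1+h≤n : suc h ≤ n) (left-std : ∀ c → 1 ≤ c → c ≤ h → StdCol n w c)
  (prefix : PrefixIn n w (suc h) α) (prefix-max : ∀ a → PrefixIn n w (suc h) a → a ≤ α)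
  (tooth : MissingTooth n w (suc h) i₁) (tooth-min : ∀ i → MissingTooth n w (suc h) i → i₁ ≤ i) where

  open Perm P

  C : ℕ → Set
  C = InCol n w (suc h)

  β : ℕ
  β = i₁ ∸ α

  1+α∉C : ¬ C (suc α)
  1+α∉C 1+α∈C = <-irrefl refl (prefix-max (suc α) longer)
    where
    longer : PrefixIn n w (suc h) (suc α)
    longer r 1≤r r≤1+α with m≤n⇒m<n∨m≡n r≤1+α
    ... | inj₁ r<1+α = prefix r 1≤r (≤-pred r<1+α)
    ... | inj₂ refl  = 1+α∈C

  α<i₁ : α < i₁
  α<i₁ with α <? i₁
  ... | yes α<i₁ = α<i₁
  ... | no  α≮i₁ = contradiction (prefix i₁ (proj₁ tooth) (≮⇒≥ α≮i₁)) (proj₁ (proj₂ tooth))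

  α+β≡i₁ : α + β ≡ i₁
  α+β≡i₁ = m+[n∸m]≡n (<⇒≤ α<i₁)

  block∉C : ∀ r → α < r → r ≤ i₁ → ¬ C r
  block∉C (suc r) (s≤s α≤r) 1+r≤i₁ with m≤n⇒m<n∨m≡n α≤r
  ... | inj₂ refl = 1+α∉C
  ... | inj₁ α<r  = λ 1+r∈C → <-irrefl refl (≤-trans 1+r≤i₁
                      (tooth-min r (≤-trans z<s α<r , block∉C r α<r (≤-trans (n≤1+n r) 1+r≤i₁) , 1+r∈C)))

  1+i₁∈C : C (suc i₁)
  1+i₁∈C = proj₂ (proj₂ tooth)

  1+i₁≤n : suc i₁ ≤ n
  1+i₁≤n = proj₂ (proj₁ (InCol⁻ n w (suc h) (suc i₁) 1+i₁∈C))

  1+h<w[1+i₁] : suc h < at w (suc i₁)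
  1+h<w[1+i₁] = InCol⇒<at n w (suc h) (suc i₁) 1+i₁∈C

  i₁≤n : i₁ ≤ n
  i₁≤n = ≤-trans (n≤1+n i₁) 1+i₁≤n

  h≤n : h ≤ n
  h≤n = ≤-trans (n≤1+n h) 1+h≤n

  block-rows : ∀ {r} → α < r → r ≤ i₁ → InBox n r
  block-rows α<r r≤i₁ = ≤-trans z<s α<r , ≤-trans r≤i₁ i₁≤n

  left-cols : ∀ {c} → 1 ≤ c → c ≤ h → InBox n c
  left-cols 1≤c c≤h = 1≤c , ≤-trans c≤h h≤n

  prefix-above : ∀ r → 1 ≤ r → r ≤ α → suc h < at w r
  prefix-above r 1≤r r≤α = InCol⇒<at n w (suc h) r (prefix r 1≤r r≤α)

  block-≤h : ∀ r → α < r → r ≤ i₁ → 1 ≤ at w r × at w r ≤ h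
  block-≤h r α<r r≤i₁ = proj₁ (at-range r 1≤r r≤n) , w[r]≤h
    where
    r∈ = block-rows α<r r≤i₁
    1≤r = proj₁ r∈
    r≤n = proj₂ r∈
    r<pos : r < pos w (suc h)
    r<pos = <-trans (s≤s r≤i₁) (InCol⇒<pos n w (suc h) (suc i₁) 1+i₁∈C)
    w[r]≤1+h : at w r ≤ suc h
    w[r]≤1+h with suc h <? at w r
    ... | yes 1+h<w = contradiction (InCol⁺ n w (suc h) r r∈ (z<s , 1+h≤n) r<pos 1+h<w) (block∉C r α<r r≤i₁)
    ... | no  1+h≮w = ≮⇒≥ 1+h≮w
    w[r]≤h : at w r ≤ h
    w[r]≤h with m≤n⇒m<n∨m≡n w[r]≤1+h
    ... | inj₁ w[r]<1+h = ≤-pred w[r]<1+h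
    ... | inj₂ eq       = contradiction (trans (sym (pos-at r 1≤r r≤n)) (cong (pos w) eq)) (<⇒≢ r<pos)

  -- Row i₁+1 lies in every standard column c ≤ h whose dot is below row i₁, hence so does the whole block.
  pos>i₁⇒<block : ∀ c → 1 ≤ c → c ≤ h → i₁ < pos w c → ∀ r → α < r → r ≤ i₁ → c < at w r
  pos>i₁⇒<block c 1≤c c≤h i₁<pos r α<r r≤i₁ with left-std c 1≤c c≤h
  ... | t , column≡[t] = InCol⇒<at n w c r (proj₂ (column≡[t] r) (proj₁ (block-rows α<r r≤i₁) , r≤t))
    where
    c∈ = left-cols 1≤c c≤h
    pos≢1+i₁ : pos w c ≢ suc i₁
    pos≢1+i₁ eq = <⇒≱ (subst (suc h <_) (trans (cong (at w) (sym eq)) (at-pos c 1≤c (proj₂ c∈))) 1+h<w[1+i₁])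
                      (≤-trans c≤h (n≤1+n h))
    1+i₁∈column : InCol n w c (suc i₁)
    1+i₁∈column = InCol⁺ n w c (suc i₁) (z<s , 1+i₁≤n) c∈ (≤∧≢⇒< i₁<pos (pos≢1+i₁ ∘ sym)) (<-trans (s≤s c≤h) 1+h<w[1+i₁])
    r≤t : r ≤ t
    r≤t = ≤-trans r≤i₁ (<⇒≤ (proj₂ (proj₁ (column≡[t] (suc i₁)) 1+i₁∈column)))

  pos>α : ∀ c → 1 ≤ c → c ≤ h → α < pos w c
  pos>α c 1≤c c≤h with α <? pos w c
  ... | yes α<pos = α<pos
  ... | no  α≮pos = contradiction (subst (suc h <_) (at-pos c 1≤c c≤n) h+1<w[pos])
                                  (≤⇒≯ (≤-trans c≤h (n≤1+n h)))
    where
    c≤n = proj₂ (left-cols 1≤c c≤h)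
    h+1<w[pos] = prefix-above (pos w c) (proj₁ (pos-range c 1≤c c≤n)) (≮⇒≥ α≮pos)

  block-index : ∀ x → x < β → α < suc α + x × suc α + x ≤ i₁
  block-index = offset-in-block α+β≡i₁

  block-row : ∀ x → x < β → InBox n (suc α + x)
  block-row x x<β = block-rows (proj₁ (block-index x x<β)) (proj₂ (block-index x x<β))

  block-value : ∀ x → x < β → 1 ≤ at w (suc α + x) × at w (suc α + x) ≤ h
  block-value x x<β = block-≤h _ (proj₁ (block-index x x<β)) (proj₂ (block-index x x<β))

  block-injective : ∀ x y → x < β → y < β → at w (suc α + x) ≡ at w (suc α + y) → x ≡ y
  block-injective x y x<β y<β eq =
    let 1≤r , r≤n = block-row x x<β ; 1≤r' , r'≤n = block-row y y<β
    in +-cancelˡ-≡ (suc α) x y (at-injective _ _ 1≤r r≤n 1≤r' r'≤n eq)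

  β≤h : β ≤ h
  β≤h = injective-on⇒≤ (λ x → at w (suc α + x) ∸ 1)
          (λ x x<β → ∸-suc-< 0 _ h (proj₁ (block-value x x<β)) (proj₂ (block-value x x<β)))
          (λ x y x<β y<β eq → block-injective x y x<β y<β
                                (∸-cancelʳ-≡ (proj₁ (block-value x x<β)) (proj₁ (block-value y y<β)) eq))

  L : ℕ
  L = h ∸ β

  L+β≡h : L + β ≡ h
  L+β≡h = m∸n+n≡m β≤h

  h∸L≡β : h ∸ L ≡ β
  h∸L≡β = m∸[m∸n]≡n β≤h

  -- The h ∸ v + 1 columns v, …, h all have their dots in the block, which has only β rows.
  block-into : ∀ r → α < r → r ≤ i₁ → L < at w r × at w r ≤ h
  block-into r α<r r≤i₁ = ∸-cancelʳ-< (subst (h ∸ v <_) (sym h∸L≡β) h∸v<β) , v≤h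
    where
    v = at w r
    1≤v = proj₁ (block-≤h r α<r r≤i₁)
    v≤h = proj₂ (block-≤h r α<r r≤i₁)
    column-range : ∀ x → x < suc (h ∸ v) → 1 ≤ v + x × v + x ≤ h
    column-range x x≤h∸v =
      ≤-trans 1≤v (m≤m+n v x) , subst (v + x ≤_) (m+[n∸m]≡n v≤h) (+-monoʳ-≤ v (≤-pred x≤h∸v))
    w[pos]≡ : ∀ x → x < suc (h ∸ v) → at w (pos w (v + x)) ≡ v + x
    w[pos]≡ x x≤ = at-pos (v + x) (proj₁ (column-range x x≤)) (≤-trans (proj₂ (column-range x x≤)) h≤n)
    pos-in-block : ∀ x → x < suc (h ∸ v) → α < pos w (v + x) × pos w (v + x) ≤ i₁
    pos-in-block x x≤ =
      let 1≤c , c≤h = column-range x x≤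
      in pos>α _ 1≤c c≤h , ≮⇒≥ λ i₁<pos → <⇒≱ (pos>i₁⇒<block _ 1≤c c≤h i₁<pos r α<r r≤i₁) (m≤m+n v x)
    h∸v<β : h ∸ v < β
    h∸v<β = injective-on⇒≤ (λ x → pos w (v + x) ∸ suc α)
      (λ x x≤ → ∸-suc-< α _ β (proj₁ (pos-in-block x x≤))
                                (subst (pos w (v + x) ≤_) (sym α+β≡i₁) (proj₂ (pos-in-block x x≤))))
      (λ x y x≤ y≤ eq → +-cancelˡ-≡ v x y (begin
         v + x                  ≡⟨ w[pos]≡ x x≤ ⟨
         at w (pos w (v + x))   ≡⟨ cong (at w) (∸-cancelʳ-≡ (proj₁ (pos-in-block x x≤)) (proj₁ (pos-in-block y y≤)) eq) ⟩
         at w (pos w (v + y))   ≡⟨ w[pos]≡ y y≤ ⟩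
         v + y                  ∎))
      where open ≡-Reasoning

  -- Otherwise all β block values would lie in (c, h], which has fewer than β elements.
  block-onto : ∀ c → L < c → c ≤ h → α < pos w c × pos w c ≤ i₁
  block-onto c L<c c≤h with i₁ <? pos w c
  ... | no  i₁≮pos = pos>α c (≤-trans z<s L<c) c≤h , ≮⇒≥ i₁≮pos
  ... | yes i₁<pos = contradiction β≤h∸c (<⇒≱ (subst (h ∸ c <_) h∸L≡β (∸-monoʳ-< L<c c≤h)))
    where
    c<block : ∀ x → x < β → c < at w (suc α + x)
    c<block x x<β = pos>i₁⇒<block c (≤-trans z<s L<c) c≤h i₁<pos _ (proj₁ (block-index x x<β)) (proj₂ (block-index x x<β))
    β≤h∸c : β ≤ h ∸ c
    β≤h∸c = injective-on⇒≤ (λ x → at w (suc α + x) ∸ suc c)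
      (λ x x<β → ∸-suc-< c _ (h ∸ c) (c<block x x<β) (subst (_ ≤_) (sym (m+[n∸m]≡n c≤h)) (proj₂ (block-value x x<β))))
      (λ x y x<β y<β eq → block-injective x y x<β y<β (∸-cancelʳ-≡ (c<block x x<β) (c<block y y<β) eq))

  block : Block n w h α i₁ β
  block = record
    { L = L ; L+β≡h = L+β≡h ; α+β≡i₁ = α+β≡i₁ ; i₁≤n = i₁≤n ; h≤n = h≤n
    ; prefix-above = λ r 1≤r r≤α → <-trans (n<1+n h) (prefix-above r 1≤r r≤α)
    ; block-into = block-into ; block-onto = block-onto
    ; block-std = λ c L<c c≤h → left-std c (≤-trans z<s L<c) c≤h }

PrimaryData⇒Block : ∀ {n w h α i₁ β} → Perm n w → PrimaryData n w h α i₁ β → Block n w h α i₁ β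
PrimaryData⇒Block P (dominant dom) = dominant⇒Block P dom
PrimaryData⇒Block P (nonDominant 1+h≤n _ left-std prefix prefix-max tooth tooth-min) =
  NonDominant.block P 1+h≤n left-std prefix prefix-max tooth tooth-min

<ᵇ-∸ : ∀ a x y → a ≤ y → (x <ᵇ y ∸ a) ≡ (a + x <ᵇ y)
<ᵇ-∸ zero    x y       _         = refl
<ᵇ-∸ (suc a) x (suc y) (s≤s a≤y) = <ᵇ-∸ a x y a≤y

≤ᵇ-∸ : ∀ a x y → a ≤ y → (x ≤ᵇ y ∸ a) ≡ (a + x ≤ᵇ y)
≤ᵇ-∸ zero    x y       _         = refl
≤ᵇ-∸ (suc a) x (suc y) (s≤s a≤y) = trans (≤ᵇ-∸ a x y a≤y) (<ᵇ-suc (a + x) y)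
  where
  <ᵇ-suc : ∀ m n → (m ≤ᵇ n) ≡ (m <ᵇ suc n)
  <ᵇ-suc zero    n = refl
  <ᵇ-suc (suc m) n = refl

≡ᵇ-∸ : ∀ a x y → a ≤ y → (x ≡ᵇ y ∸ a) ≡ (a + x ≡ᵇ y)
≡ᵇ-∸ zero    x y       _         = refl
≡ᵇ-∸ (suc a) x (suc y) (s≤s a≤y) = ≡ᵇ-∸ a x y a≤y

data RowRegion (α i₁ r : ℕ) : Set where
  prefix : r ≤ α → RowRegion α i₁ r
  block  : α < r → r ≤ i₁ → RowRegion α i₁ r
  suffix : i₁ < r → RowRegion α i₁ r

rowRegion : ∀ α i₁ r → RowRegion α i₁ r
rowRegion α i₁ r with α <? r | i₁ <? r
... | no  α≮r | _       = prefix (≮⇒≥ α≮r)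
... | yes α<r | no i₁≮r = block α<r (≮⇒≥ i₁≮r)
... | yes _   | yes i₁<r = suffix i₁<r

module BlockSorting {n w h α i₁ β} (w-perm : IsPerm n w) (primary : PrimaryData n w h α i₁ β) where

  P : Perm n w
  P = isPerm⇒Perm w-perm
  open Perm P public
  open Block (PrimaryData⇒Block P primary) public

  α≤i₁ : α ≤ i₁
  α≤i₁ = subst (α ≤_) α+β≡i₁ (m≤m+n α β)

  α≤n : α ≤ n
  α≤n = ≤-trans α≤i₁ i₁≤n

  A Y Z S ws : List ℕ
  A  = take α w
  Y  = take β (drop α w)
  Z  = drop i₁ w
  S  = sort Y
  ws = wsort w α i₁

  w≡A++Y++Z : w ≡ A ++ Y ++ Z
  w≡A++Y++Z = sym (begin
    A ++ Y ++ drop i₁ w            ≡⟨ cong (λ k → A ++ Y ++ drop k w) α+β≡i₁ ⟨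
    A ++ Y ++ drop (α + β) w       ≡⟨ cong (λ zs → A ++ Y ++ zs) (drop-drop α β w) ⟨
    A ++ Y ++ drop β (drop α w)    ≡⟨ cong (A ++_) (take++drop≡id β (drop α w)) ⟩
    A ++ drop α w                  ≡⟨ take++drop≡id α w ⟩
    w                              ∎)
    where open ≡-Reasoning

  ws≡A++S++Z : ws ≡ A ++ S ++ Z
  ws≡A++S++Z = cong (λ k → A ++ sort (take k (drop α w)) ++ Z) (trans (cong (_∸ α) (sym α+β≡i₁)) (m+n∸m≡n α β))

  length-A : length A ≡ α
  length-A = trans (length-take α w) (trans (cong (α ⊓_) length≡) (m≤n⇒m⊓n≡m α≤n))

  length-Y : length Y ≡ β
  length-Y = trans (length-take β (drop α w))
                   (trans (cong (β ⊓_) (trans (length-drop α w) (cong (_∸ α) length≡))) (m≤n⇒m⊓n≡m β≤n∸α))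
    where
    β≤n∸α : β ≤ n ∸ α
    β≤n∸α = subst (_≤ n ∸ α) (m+n∸m≡n α β) (∸-monoˡ-≤ α (subst (_≤ n) (sym α+β≡i₁) i₁≤n))

  length-S : length S ≡ β
  length-S = trans (↭-length (sort-↭ Y)) length-Y

  ws-perm : IsPerm n ws
  ws-perm = subst (_↭ range1 n) (sym ws≡A++S++Z)
              (↭-trans (++⁺ˡ A (++⁺ʳ Z (sort-↭ Y))) (subst (_↭ range1 n) w≡A++Y++Z w-perm))

  Q : Perm n ws
  Q = isPerm⇒Perm ws-perm

  Dw Dws : Diagram
  Dw  = rothe n w
  Dws = rothe n ws

  ws-outside : ∀ r → r ≤ α ⊎ i₁ < r → at ws r ≡ at w r
  ws-outside r outside = begin
    at ws r              ≡⟨ cong (λ u → at u r) ws≡A++S++Z ⟩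
    at (A ++ S ++ Z) r   ≡⟨ at-++-++-outside A S Y Z r (trans length-S (sym length-Y)) (Data.Sum.map r≤A A+S<r outside) ⟩
    at (A ++ Y ++ Z) r   ≡⟨ cong (λ u → at u r) w≡A++Y++Z ⟨
    at w r               ∎
    where
    open ≡-Reasoning
    r≤A : r ≤ α → r ≤ length A
    r≤A = subst (r ≤_) (sym length-A)
    A+S<r : i₁ < r → length A + length S < r
    A+S<r = subst (_< r) (sym (trans (cong₂ _+_ length-A length-S) α+β≡i₁))

  ws-inside : ∀ q → q < β → at ws (suc (α + q)) ≡ at S (suc q)
  ws-inside q q<β = begin
    at ws (suc (α + q))                      ≡⟨ cong (λ u → at u (suc (α + q))) ws≡A++S++Z ⟩
    at (A ++ S ++ Z) (suc (α + q))           ≡⟨ cong (λ k → at (A ++ S ++ Z) (suc (k + q))) length-A ⟨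
    at (A ++ S ++ Z) (suc (length A + q))    ≡⟨ at-++-++-inside A S Z q (subst (q <_) (sym length-S) q<β) ⟩
    at S (suc q)                             ∎
    where open ≡-Reasoning

  w-inside : ∀ q → q < β → at w (suc (α + q)) ≡ at Y (suc q)
  w-inside q q<β = begin
    at w (suc (α + q))                       ≡⟨ cong (λ u → at u (suc (α + q))) w≡A++Y++Z ⟩
    at (A ++ Y ++ Z) (suc (α + q))           ≡⟨ cong (λ k → at (A ++ Y ++ Z) (suc (k + q))) length-A ⟨
    at (A ++ Y ++ Z) (suc (length A + q))    ≡⟨ at-++-++-inside A Y Z q (subst (q <_) (sym length-Y) q<β) ⟩
    at Y (suc q)                             ∎
    where open ≡-Reasoning

  block-offset : ∀ r → α < r → r ≤ i₁ → Σ ℕ λ q → q < β × r ≡ suc (α + q)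
  block-offset (suc r) (s≤s α≤r) 1+r≤i₁ = r ∸ α , r∸α<β , cong suc (sym (m+[n∸m]≡n α≤r))
    where
    r∸α<β : r ∸ α < β
    r∸α<β = subst (r ∸ α <_) (m+n∸m≡n α β) (∸-monoˡ-< (subst (r <_) (sym α+β≡i₁) 1+r≤i₁) α≤r)

  block-index : ∀ q → q < β → α < suc (α + q) × suc (α + q) ≤ i₁
  block-index = offset-in-block α+β≡i₁

  block-rows : ∀ {r} → α < r → r ≤ i₁ → InBox n r
  block-rows α<r r≤i₁ = ≤-trans z<s α<r , ≤-trans r≤i₁ i₁≤n

  middle-cols : ∀ {c} → L < c → c ≤ h → InBox n c
  middle-cols L<c c≤h = ≤-trans z<s L<c , ≤-trans c≤h h≤n

  ws-block-into : ∀ r → α < r → r ≤ i₁ → L < at ws r × at ws r ≤ h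
  ws-block-into r α<r r≤i₁ with block-offset r α<r r≤i₁
  ... | q , q<β , refl with ∈⇒at Y (∈-resp-↭ (sort-↭ Y) (at-∈ S q (subst (q <_) (sym length-S) q<β)))
  ... | q' , q'<Y , Y[q']≡S[q] =
    subst (λ v → L < v × v ≤ h) (trans (trans (w-inside q' q'<β) Y[q']≡S[q]) (sym (ws-inside q q<β)))
          (block-into (suc (α + q')) (proj₁ (block-index q' q'<β)) (proj₂ (block-index q' q'<β)))
    where q'<β = subst (q' <_) length-Y q'<Y

  ws-block-increasing : ∀ r r' → α < r → r < r' → r' ≤ i₁ → at ws r < at ws r'
  ws-block-increasing r r' α<r r<r' r'≤i₁
    with block-offset r α<r (≤-trans (<⇒≤ r<r') r'≤i₁) | block-offset r' (<-trans α<r r<r') r'≤i₁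
  ... | q , q<β , refl | q' , q'<β , refl = ≤∧≢⇒< ≤ws[r'] ≢ws[r']
    where
    ≤ws[r'] : at ws (suc (α + q)) ≤ at ws (suc (α + q'))
    ≤ws[r'] = subst₂ _≤_ (sym (ws-inside q q<β)) (sym (ws-inside q' q'<β))
                (Linked-at-mono (sort-↗ Y) (<⇒≤ (+-cancelˡ-< α q q' (≤-pred r<r'))) (subst (q' <_) (sym length-S) q'<β))
    r∈ = block-rows α<r (≤-trans (<⇒≤ r<r') r'≤i₁)
    r'∈ = block-rows (<-trans α<r r<r') r'≤i₁
    ≢ws[r'] : at ws (suc (α + q)) ≢ at ws (suc (α + q'))
    ≢ws[r'] eq = <⇒≢ r<r' (Perm.at-injective Q _ _ (proj₁ r∈) (proj₂ r∈) (proj₁ r'∈) (proj₂ r'∈) eq)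

  pos-w≡pos-ws : ∀ c → InBox n c → pos ws c ≤ α ⊎ i₁ < pos ws c → pos w c ≡ pos ws c
  pos-w≡pos-ws c (1≤c , c≤n) outside = begin
    pos w c                    ≡⟨ cong (pos w) (Perm.at-pos Q c 1≤c c≤n) ⟨
    pos w (at ws (pos ws c))   ≡⟨ cong (pos w) (ws-outside _ outside) ⟩
    pos w (at w (pos ws c))    ≡⟨ pos-at (pos ws c) (proj₁ p∈) (proj₂ p∈) ⟩
    pos ws c                   ∎
    where
    open ≡-Reasoning
    p∈ = Perm.pos-range Q c 1≤c c≤n

  pos-ws-block : ∀ c → L < c → c ≤ h → α < pos ws c × pos ws c ≤ i₁
  pos-ws-block c L<c c≤h with rowRegion α i₁ (pos ws c)
  ... | block α<p p≤i₁ = α<p , p≤i₁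
  ... | prefix p≤α  =
    contradiction (subst (α <_) (pos-w≡pos-ws c (middle-cols L<c c≤h) (inj₁ p≤α)) (proj₁ (block-onto c L<c c≤h))) (≤⇒≯ p≤α)
  ... | suffix i₁<p =
    contradiction (subst (_≤ i₁) (pos-w≡pos-ws c (middle-cols L<c c≤h) (inj₂ i₁<p)) (proj₂ (block-onto c L<c c≤h))) (<⇒≱ i₁<p)

  pos-w-outside : ∀ c → InBox n c → c ≤ L ⊎ h < c → pos w c ≤ α ⊎ i₁ < pos w c
  pos-w-outside c (1≤c , c≤n) outside with rowRegion α i₁ (pos w c)
  ... | prefix p≤α     = inj₁ p≤α
  ... | suffix i₁<p    = inj₂ i₁<p
  ... | block α<p p≤i₁ with outside | block-into (pos w c) α<p p≤i₁
  ...   | inj₁ c≤L | L<w[p] , _ = contradiction (subst (L <_) (at-pos c 1≤c c≤n) L<w[p]) (≤⇒≯ c≤L)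
  ...   | inj₂ h<c | _ , w[p]≤h = contradiction (subst (_≤ h) (at-pos c 1≤c c≤n) w[p]≤h) (<⇒≱ h<c)

  pos-ws≡pos-w : ∀ c → InBox n c → c ≤ L ⊎ h < c → pos ws c ≡ pos w c
  pos-ws≡pos-w c (1≤c , c≤n) outside = begin
    pos ws c                    ≡⟨ cong (pos ws) (at-pos c 1≤c c≤n) ⟨
    pos ws (at w (pos w c))     ≡⟨ cong (pos ws) (ws-outside _ (pos-w-outside c (1≤c , c≤n) outside)) ⟨
    pos ws (at ws (pos w c))    ≡⟨ Perm.pos-at Q (pos w c) (proj₁ p∈) (proj₂ p∈) ⟩
    pos w c                     ∎
    where
    open ≡-Reasoning
    p∈ = pos-range c 1≤c c≤n

  outside-column-cells : ∀ c → InBox n c → c ≤ L ⊎ h < c → ∀ r → inversion w r c ≡ inversion ws r c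
  outside-column-cells c c∈ outside r rewrite pos-ws≡pos-w c c∈ outside with rowRegion α i₁ r
  ... | prefix r≤α  = cong (λ v → (r <ᵇ pos w c) ∧ (c <ᵇ v)) (sym (ws-outside r (inj₁ r≤α)))
  ... | suffix i₁<r = cong (λ v → (r <ᵇ pos w c) ∧ (c <ᵇ v)) (sym (ws-outside r (inj₂ i₁<r)))
  ... | block α<r r≤i₁ with pos-w-outside c c∈ outside | outside
  ...   | inj₁ p≤α  | _ rewrite dec-false (r <? pos w c) (≤⇒≯ (≤-trans p≤α (<⇒≤ α<r))) = refl
  ...   | inj₂ i₁<p | inj₁ c≤L
    rewrite dec-true (r <? pos w c) (≤-<-trans r≤i₁ i₁<p)
          | dec-true (c <? at w r) (≤-<-trans c≤L (proj₁ (block-into r α<r r≤i₁)))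
          | dec-true (c <? at ws r) (≤-<-trans c≤L (proj₁ (ws-block-into r α<r r≤i₁))) = refl
  ...   | inj₂ i₁<p | inj₂ h<c
    rewrite dec-true (r <? pos w c) (≤-<-trans r≤i₁ i₁<p)
          | dec-false (c <? at w r) (≤⇒≯ (≤-trans (proj₂ (block-into r α<r r≤i₁)) (<⇒≤ h<c)))
          | dec-false (c <? at ws r) (≤⇒≯ (≤-trans (proj₂ (ws-block-into r α<r r≤i₁)) (<⇒≤ h<c))) = refl

  outside-column : ∀ c → InBox n c → c ≤ L ⊎ h < c → ∀ r → Dw r c ≡ Dws r c
  outside-column c c∈ outside r = mem-cong n (inversion w) (inversion ws) (outside-column-cells c c∈ outside r)

  ws-middle-column : ∀ c → L < c → c ≤ h → StandardColumn n Dws c α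
  ws-middle-column c L<c c≤h r r∈@(1≤r , _) =
    trans (mem-idem n (inversion ws) r c) (trans (mem-inside n (inversion ws) r∈ c∈) (cell (rowRegion α i₁ r)))
    where
    c∈ = middle-cols L<c c≤h
    p = pos ws c
    α<p = proj₁ (pos-ws-block c L<c c≤h)
    p≤i₁ = proj₂ (pos-ws-block c L<c c≤h)
    cell : RowRegion α i₁ r → inversion ws r c ≡ (r ≤ᵇ α)
    cell (prefix r≤α)
      rewrite dec-true (r <? p) (≤-<-trans r≤α α<p)
            | ws-outside r (inj₁ r≤α)
            | dec-true (c <? at w r) (≤-<-trans c≤h (prefix-above r 1≤r r≤α))
            | dec-true (r ≤? α) r≤α = refl
    cell (suffix i₁<r)
      rewrite dec-false (r <? p) (≤⇒≯ (≤-trans p≤i₁ (<⇒≤ i₁<r)))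
            | dec-false (r ≤? α) (<⇒≱ (≤-<-trans α≤i₁ i₁<r)) = refl
    cell (block α<r r≤i₁) rewrite dec-false (r ≤? α) (<⇒≱ α<r) with r <? p
    ... | no  r≮p rewrite dec-false (r <? p) r≮p = refl
    ... | yes r<p
      rewrite dec-true (r <? p) r<p
            | dec-false (c <? at ws r) (<⇒≯ (subst (at ws r <_) (Perm.at-pos Q c (proj₁ c∈) (proj₂ c∈))
                                                  (ws-block-increasing r p α<r r<p p≤i₁))) = refl

  w-middle-column : ∀ c → L < c → c ≤ h → Σ ℕ λ t → α ≤ t × t < i₁ × StandardColumn n Dw c t
  w-middle-column c L<c c≤h with block-std c L<c c≤h
  ... | std@(t , column≡[t]) = t , α≤t , t<i₁ , StdCol⇒StandardColumn {n} {w} {c} std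
    where
    c∈ = middle-cols L<c c≤h
    α<p = proj₁ (block-onto c L<c c≤h)
    p≤i₁ = proj₂ (block-onto c L<c c≤h)
    α≤t : α ≤ t
    α≤t with 1 ≤? α
    ... | no  α≱1 = ≤-trans (≤-pred (≰⇒> α≱1)) z≤n
    ... | yes 1≤α = proj₂ (proj₁ (column≡[t] α) (InCol⁺ n w c α (1≤α , α≤n) c∈ α<p (≤-<-trans c≤h (prefix-above α 1≤α ≤-refl))))
    t<i₁ : t < i₁
    t<i₁ with 1 ≤? t
    ... | no  t≱1 = ≤-trans (s≤s (≤-pred (≰⇒> t≱1))) (≤-trans z<s (<-≤-trans α<p p≤i₁))
    ... | yes 1≤t = <-≤-trans (InCol⇒<pos n w c t (proj₂ (column≡[t] t) (1≤t , ≤-refl))) p≤i₁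

  σ : List ℕ
  σ = sigma w h α β

  Dσ : Diagram
  Dσ = rothe β σ

  h∸β≡L : h ∸ β ≡ L
  h∸β≡L = trans (cong (_∸ β) (sym L+β≡h)) (m+n∸n≡m L β)

  length-σ : length σ ≡ β
  length-σ = trans (length-map (_∸ (h ∸ β)) Y) length-Y

  at-σ : ∀ q → q < β → at σ (suc q) ≡ at w (suc (α + q)) ∸ L
  at-σ q q<β = trans (at-map (_∸ (h ∸ β)) Y q (subst (q <_) (sym length-Y) q<β))
                     (cong₂ _∸_ (sym (w-inside q q<β)) h∸β≡L)

  σ-injective : ∀ q q' → q < β → q' < β → at σ (suc q) ≡ at σ (suc q') → q ≡ q'
  σ-injective q q' q<β q'<β eq =
    +-cancelˡ-≡ (suc α) q q' (at-injective _ _ (proj₁ r∈) (proj₂ r∈) (proj₁ r'∈) (proj₂ r'∈)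
      (∸-cancelʳ-≡ (<⇒≤ (proj₁ (block-into _ α<r r≤i₁))) (<⇒≤ (proj₁ (block-into _ α<r' r'≤i₁)))
                   (trans (sym (at-σ q q<β)) (trans eq (at-σ q' q'<β)))))
    where
    α<r = proj₁ (block-index q q<β) ; r≤i₁ = proj₂ (block-index q q<β)
    α<r' = proj₁ (block-index q' q'<β) ; r'≤i₁ = proj₂ (block-index q' q'<β)
    r∈ = block-rows α<r r≤i₁ ; r'∈ = block-rows α<r' r'≤i₁

  pos-σ : ∀ c → L < c → c ≤ h → pos σ (c ∸ L) ≡ pos w c ∸ α
  pos-σ c L<c c≤h with block-offset (pos w c) (proj₁ (block-onto c L<c c≤h)) (proj₂ (block-onto c L<c c≤h))
  ... | q₀ , q₀<β , pos≡ = begin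
    pos σ (c ∸ L)             ≡⟨ cong (pos σ) σ[q₀]≡c∸L ⟨
    pos σ (at σ (suc q₀))     ≡⟨ pos-at-first σ q₀ (subst (q₀ <_) (sym length-σ) q₀<β) first ⟩
    suc q₀                    ≡⟨ m+n∸m≡n α (suc q₀) ⟨
    α + suc q₀ ∸ α            ≡⟨ cong (_∸ α) (trans (+-suc α q₀) (sym pos≡)) ⟩
    pos w c ∸ α               ∎
    where
    open ≡-Reasoning
    c∈ = middle-cols L<c c≤h
    σ[q₀]≡c∸L : at σ (suc q₀) ≡ c ∸ L
    σ[q₀]≡c∸L = trans (at-σ q₀ q₀<β) (cong (_∸ L) (trans (cong (at w) (sym pos≡)) (at-pos c (proj₁ c∈) (proj₂ c∈))))
    first : ∀ q → q < q₀ → at σ (suc q) ≢ at σ (suc q₀)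
    first q q<q₀ eq = <⇒≢ q<q₀ (σ-injective q q₀ (<-trans q<q₀ q₀<β) q₀<β eq)

  L+p-in-middle : ∀ {p} → 1 ≤ p → p ≤ β → L < L + p × L + p ≤ h
  L+p-in-middle {p} 1≤p p≤β = m<m+n L 1≤p , subst (L + p ≤_) L+β≡h (+-monoʳ-≤ L p≤β)

  σ-column : ∀ p → 1 ≤ p → p ≤ β → ∀ t → α ≤ t → StandardColumn n Dw (L + p) t →
             StandardColumn β Dσ p (t ∸ α)
  σ-column p 1≤p p≤β t α≤t std (suc q) r∈@(_ , 1+q≤β) = begin
    mem β Dσ (suc q) p
      ≡⟨ mem-idem β (inversion σ) (suc q) p ⟩
    Dσ (suc q) p
      ≡⟨ mem-inside β (inversion σ) r∈ (1≤p , p≤β) ⟩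
    (suc q <ᵇ pos σ p) ∧ (p <ᵇ at σ (suc q))
      ≡⟨ cong₂ (λ x y → (suc q <ᵇ x) ∧ (p <ᵇ y)) pos-σ[p] (at-σ q 1+q≤β) ⟩
    (suc q <ᵇ pos w c ∸ α) ∧ (p <ᵇ at w (suc (α + q)) ∸ L)
      ≡⟨ cong₂ _∧_ (<ᵇ-∸ α (suc q) (pos w c) (<⇒≤ α<pos)) (<ᵇ-∸ L p _ (<⇒≤ L<w)) ⟩
    (α + suc q <ᵇ pos w c) ∧ (c <ᵇ at w (suc (α + q)))
      ≡⟨ cong (λ r → (α + suc q <ᵇ pos w c) ∧ (c <ᵇ at w r)) (+-suc α q) ⟨
    (α + suc q <ᵇ pos w c) ∧ (c <ᵇ at w (α + suc q))
      ≡⟨ mem-inside n (inversion w) r'∈ c∈ ⟨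
    Dw (α + suc q) c
      ≡⟨ mem-idem n (inversion w) (α + suc q) c ⟨
    mem n Dw (α + suc q) c
      ≡⟨ std (α + suc q) r'∈ ⟩
    (α + suc q ≤ᵇ t)
      ≡⟨ ≤ᵇ-∸ α (suc q) t α≤t ⟨
    (suc q ≤ᵇ t ∸ α)
      ∎
    where
    open ≡-Reasoning
    c = L + p
    L<c = proj₁ (L+p-in-middle 1≤p p≤β)
    c≤h = proj₂ (L+p-in-middle 1≤p p≤β)
    c∈ = middle-cols L<c c≤h
    α<pos = proj₁ (block-onto c L<c c≤h)
    pos-σ[p] : pos σ p ≡ pos w c ∸ α
    pos-σ[p] = trans (cong (pos σ) (sym (m+n∸m≡n L p))) (pos-σ c L<c c≤h)
    α<r = proj₁ (block-index q 1+q≤β)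
    r≤i₁ = proj₂ (block-index q 1+q≤β)
    L<w = proj₁ (block-into (suc (α + q)) α<r r≤i₁)
    r'∈ : InBox n (α + suc q)
    r'∈ = subst (InBox n) (sym (+-suc α q)) (block-rows α<r r≤i₁)

  clear0-ws≐clear0-w : clear0 n Dws ≐ clear0 n Dw
  clear0-ws≐clear0-w r c with inBox? n c
  ... | no c∉ = trans (clear0-false n Dws r c (mem-outside-col n (inversion ws) r c∉))
                      (sym (clear0-false n Dw r c (mem-outside-col n (inversion w) r c∉)))
  ... | yes c∈ with L <? c | h <? c
  ...   | no L≮c | _ = clear0-cong n Dws Dw c (λ r → sym (outside-column c c∈ (inj₁ (≮⇒≥ L≮c)) r)) r
  ...   | yes _  | yes h<c = clear0-cong n Dws Dw c (λ r → sym (outside-column c c∈ (inj₂ h<c) r)) r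
  ...   | yes L<c | no h≮c with w-middle-column c L<c (≮⇒≥ h≮c)
  ...     | t , _ , t<i₁ , std =
    trans (clear0-standard n Dws c (ws-middle-column c L<c (≮⇒≥ h≮c)) α≤n (supported ws) r)
          (sym (clear0-standard n Dw c std (≤-trans (<⇒≤ t<i₁) i₁≤n) (supported w) r))
    where
    supported : ∀ u r → rothe n u r c ≡ mem n (rothe n u) r c
    supported u r = sym (mem-idem n (inversion u) r c)

  isCol : Diagram → ℕ → ℕ → ℕ
  isCol D j c = 𝟙 (colIsᵇ n D c j)

  ∑-three-parts : ∀ F → ∑ F 1 n ≡ ∑ F 1 L + ∑ (λ p → F (L + p)) 1 β + ∑ F (suc h) (n ∸ h)
  ∑-three-parts F = begin
    ∑ F 1 n
      ≡⟨ cong (∑ F 1) (m+[n∸m]≡n h≤n) ⟨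
    ∑ F 1 (h + (n ∸ h))
      ≡⟨ ∑-split F 1 h (n ∸ h) ⟩
    ∑ F 1 h + right
      ≡⟨ cong (λ k → ∑ F 1 k + right) L+β≡h ⟨
    ∑ F 1 (L + β) + right
      ≡⟨ cong (_+ right) (∑-split F 1 L β) ⟩
    ∑ F 1 L + ∑ F (1 + L) β + right
      ≡⟨ cong (λ a → ∑ F 1 L + ∑ F a β + right) (+-comm 1 L) ⟩
    ∑ F 1 L + ∑ F (L + 1) β + right
      ≡⟨ cong (λ m → ∑ F 1 L + m + right) (∑-shift F L 1 β) ⟩
    ∑ F 1 L + ∑ (λ p → F (L + p)) 1 β + right
      ∎
    where
    open ≡-Reasoning
    right = ∑ F (suc h) (n ∸ h)

  outer middle : Diagram → ℕ → ℕ
  outer  D j = ∑ (isCol D j) 1 L + ∑ (isCol D j) (suc h) (n ∸ h)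
  middle D j = ∑ (λ p → isCol D j (L + p)) 1 β

  count≡outer+middle : ∀ D j → count n D j ≡ outer D j + middle D j
  count≡outer+middle D j = begin
    count n D j
      ≡⟨ count≡∑ n D j ⟩
    ∑ (isCol D j) 1 n
      ≡⟨ ∑-three-parts (isCol D j) ⟩
    ∑ (isCol D j) 1 L + middle D j + ∑ (isCol D j) (suc h) (n ∸ h)
      ≡⟨ xy∙z≈xz∙y (∑ (isCol D j) 1 L) (middle D j) _ ⟩
    outer D j + middle D j
      ∎
    where open ≡-Reasoning

  outer-ws≡outer-w : ∀ j → outer Dws j ≡ outer Dw j
  outer-ws≡outer-w j = cong₂ _+_
    (∑-cong 1 L λ c 1≤c c<1+L → same c (1≤c , ≤-trans (≤-pred c<1+L) L≤n) (inj₁ (≤-pred c<1+L)))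
    (∑-cong (suc h) (n ∸ h) λ c h<c c<1+n → same c (≤-trans z<s h<c , ≤-pred (subst (c <_) h+[n∸h]≡n c<1+n)) (inj₂ h<c))
    where
    L≤n = ≤-trans (m≤m+n L β) (subst (_≤ n) (sym L+β≡h) h≤n)
    h+[n∸h]≡n = cong suc (m+[n∸m]≡n h≤n)
    same : ∀ c → InBox n c → c ≤ L ⊎ h < c → isCol Dws j c ≡ isCol Dw j c
    same c c∈ outside = cong 𝟙 (colIsᵇ-cong n Dws Dw c (λ r → sym (outside-column c c∈ outside r)) j)

  ws-middle-colIs : ∀ p → 1 ≤ p → p ≤ β → ∀ j → j ≤ n → colIsᵇ n Dws (L + p) j ≡ (j ≡ᵇ α)
  ws-middle-colIs p 1≤p p≤β j j≤n =
    colIsᵇ-standard n Dws (L + p) (ws-middle-column (L + p) L<c c≤h) α≤n j≤n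
    where L<c = proj₁ (L+p-in-middle 1≤p p≤β) ; c≤h = proj₂ (L+p-in-middle 1≤p p≤β)

  middle-ws-α : middle Dws α ≡ β
  middle-ws-α = trans (∑-≡const 1 1 β λ p 1≤p p<1+β →
                        cong 𝟙 (trans (ws-middle-colIs p 1≤p (≤-pred p<1+β) α α≤n) (dec-true (α ≟ α) refl)))
                      (*-identityʳ β)

  middle-ws-≢α : ∀ j → j ≤ n → j ≢ α → middle Dws j ≡ 0
  middle-ws-≢α j j≤n j≢α = trans (∑-≡const 0 1 β λ p 1≤p p<1+β →
                                   cong 𝟙 (trans (ws-middle-colIs p 1≤p (≤-pred p<1+β) j j≤n) (dec-false (j ≟ α) j≢α)))
                                 (*-zeroʳ β)

  record MiddleColumn (p : ℕ) : Set where
    field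
      t     : ℕ
      α≤t   : α ≤ t
      t<i₁  : t < i₁
      w-col : ∀ j → j ≤ n → colIsᵇ n Dw (L + p) j ≡ (j ≡ᵇ t)
      σ-col : ∀ j → j ≤ β → colIsᵇ β Dσ p j ≡ (j ≡ᵇ t ∸ α)

  ≤i₁⇒∸α≤β : ∀ {t} → t ≤ i₁ → t ∸ α ≤ β
  ≤i₁⇒∸α≤β {t} t≤i₁ = subst (t ∸ α ≤_) (m+n∸m≡n α β) (∸-monoˡ-≤ α (subst (t ≤_) (sym α+β≡i₁) t≤i₁))

  middleColumn : ∀ p → 1 ≤ p → p ≤ β → MiddleColumn p
  middleColumn p 1≤p p≤β with w-middle-column (L + p) (proj₁ (L+p-in-middle 1≤p p≤β)) (proj₂ (L+p-in-middle 1≤p p≤β))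
  ... | t , α≤t , t<i₁ , std = record
    { t = t ; α≤t = α≤t ; t<i₁ = t<i₁
    ; w-col = λ j j≤n → colIsᵇ-standard n Dw (L + p) std (≤-trans (<⇒≤ t<i₁) i₁≤n) j≤n
    ; σ-col = λ j j≤β → colIsᵇ-standard β Dσ p (σ-column p 1≤p p≤β t α≤t std) (≤i₁⇒∸α≤β (<⇒≤ t<i₁)) j≤β }

  middle-w-zero : ∀ j → j ≤ n → (∀ t → α ≤ t → t < i₁ → j ≢ t) → middle Dw j ≡ 0
  middle-w-zero j j≤n j∉block =
    trans (∑-≡const 0 1 β λ p 1≤p p<1+β → column-zero (middleColumn p 1≤p (≤-pred p<1+β))) (*-zeroʳ β)
    where
    column-zero : ∀ {p} → MiddleColumn p → isCol Dw j (L + p) ≡ 0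
    column-zero m = cong 𝟙 (trans (w-col j j≤n) (dec-false (j ≟ t) (j∉block t α≤t t<i₁)))
      where open MiddleColumn m

  middle-w≡kσ : ∀ j → α < j → j ≤ i₁ → middle Dw j ≡ count β Dσ (j ∸ α)
  middle-w≡kσ j α<j j≤i₁ = sym (trans (count≡∑ β Dσ (j ∸ α))
                                      (∑-cong 1 β λ p 1≤p p<1+β → same-column p (middleColumn p 1≤p (≤-pred p<1+β))))
    where
    same-column : ∀ p → MiddleColumn p → 𝟙 (colIsᵇ β Dσ p (j ∸ α)) ≡ isCol Dw j (L + p)
    same-column p m = cong 𝟙 (begin
      colIsᵇ β Dσ p (j ∸ α)   ≡⟨ σ-col (j ∸ α) (≤i₁⇒∸α≤β j≤i₁) ⟩
      (j ∸ α ≡ᵇ t ∸ α)        ≡⟨ ≡ᵇ-∸ α (j ∸ α) t α≤t ⟩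
      (α + (j ∸ α) ≡ᵇ t)      ≡⟨ cong (_≡ᵇ t) (m+[n∸m]≡n (<⇒≤ α<j)) ⟩
      (j ≡ᵇ t)                ≡⟨ w-col j (≤-trans j≤i₁ i₁≤n) ⟨
      colIsᵇ n Dw (L + p) j   ∎)
      where
      open ≡-Reasoning
      open MiddleColumn m

  Σkσ : ℕ
  Σkσ = sum (map (count β Dσ) (range1 β))

  middle-w-α : middle Dw α + Σkσ ≡ β
  middle-w-α = begin
    middle Dw α + Σkσ
      ≡⟨ cong (middle Dw α +_) (trans (cong (sum ∘ map (count β Dσ)) (range1≡interval β))
                                        (trans (∑-cong 1 β λ j _ _ → count≡∑ β Dσ j) (∑-comm σ-isCol 1 β 1 β))) ⟩
    middle Dw α + ∑ (λ p → ∑ (λ j → σ-isCol j p) 1 β) 1 β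
      ≡⟨ ∑-+ _ _ 1 β ⟨
    ∑ (λ p → isCol Dw α (L + p) + ∑ (λ j → σ-isCol j p) 1 β) 1 β
      ≡⟨ ∑-≡const 1 1 β (λ p 1≤p p<1+β → one-cell p (middleColumn p 1≤p (≤-pred p<1+β))) ⟩
    β * 1
      ≡⟨ *-identityʳ β ⟩
    β ∎
    where
    open ≡-Reasoning
    σ-isCol : ℕ → ℕ → ℕ
    σ-isCol j p = 𝟙 (colIsᵇ β Dσ p j)
    -- Column L + p of D(w) is [α] exactly when column p of D(σ) is empty, so together the two
    -- counts see the single value t ∸ α ∈ [0, β].
    one-cell : ∀ p → MiddleColumn p → isCol Dw α (L + p) + ∑ (λ j → σ-isCol j p) 1 β ≡ 1
    one-cell p m = begin
      isCol Dw α (L + p) + ∑ (λ j → σ-isCol j p) 1 β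
        ≡⟨ cong₂ _+_ (cong 𝟙 (trans (w-col α α≤n) α≡ᵇt≡0≡ᵇt∸α)) (∑-cong 1 β λ j _ j<1+β → cong 𝟙 (σ-col j (≤-pred j<1+β))) ⟩
      ∑ (λ j → 𝟙 (j ≡ᵇ t ∸ α)) 0 (suc β)
        ≡⟨ ∑-indicator (t ∸ α) 0 (suc β) z≤n (s≤s (≤i₁⇒∸α≤β (<⇒≤ t<i₁))) ⟩
      1 ∎
      where
      open MiddleColumn m
      α≡ᵇt≡0≡ᵇt∸α : (α ≡ᵇ t) ≡ (0 ≡ᵇ t ∸ α)
      α≡ᵇt≡0≡ᵇt∸α = trans (cong (_≡ᵇ t) (sym (+-identityʳ α))) (sym (≡ᵇ-∸ α 0 t α≤t))

  count-ws≡outer+middle : ∀ j → count n Dws j ≡ outer Dw j + middle Dws j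
  count-ws≡outer+middle j = trans (count≡outer+middle Dws j) (cong (_+ middle Dws j) (outer-ws≡outer-w j))

  count-off-block : ∀ j → j ≤ n → j < α ⊎ i₁ < j → count n Dw j ≡ count n Dws j
  count-off-block j j≤n off = begin
    count n Dw j
      ≡⟨ count≡outer+middle Dw j ⟩
    outer Dw j + middle Dw j
      ≡⟨ cong (outer Dw j +_) (trans (middle-w-zero j j≤n j∉block) (sym (middle-ws-≢α j j≤n j≢α))) ⟩
    outer Dw j + middle Dws j
      ≡⟨ count-ws≡outer+middle j ⟨
    count n Dws j
      ∎
    where
    open ≡-Reasoning
    j∉block : ∀ t → α ≤ t → t < i₁ → j ≢ t
    j∉block t α≤t t<i₁ refl = [ (λ j<α → <⇒≱ j<α α≤t) , (λ i₁<j → <-asym t<i₁ i₁<j) ]′ off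
    j≢α : j ≢ α
    j≢α refl = [ <-irrefl refl , (λ i₁<j → <⇒≱ i₁<j α≤i₁) ]′ off

  count-α : count n Dw α + Σkσ ≡ count n Dws α
  count-α = begin
    count n Dw α + Σkσ                 ≡⟨ cong (_+ Σkσ) (count≡outer+middle Dw α) ⟩
    outer Dw α + middle Dw α + Σkσ     ≡⟨ +-assoc (outer Dw α) _ _ ⟩
    outer Dw α + (middle Dw α + Σkσ)   ≡⟨ cong (outer Dw α +_) (trans middle-w-α (sym middle-ws-α)) ⟩
    outer Dw α + middle Dws α          ≡⟨ count-ws≡outer+middle α ⟨
    count n Dws α                      ∎
    where open ≡-Reasoning

  count-block : ∀ j → α < j → j ≤ i₁ → count n Dw j ≡ count n Dws j + count β Dσ (j ∸ α)
  count-block j α<j j≤i₁ = begin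
    count n Dw j                  ≡⟨ count≡outer+middle Dw j ⟩
    outer Dw j + middle Dw j      ≡⟨ cong₂ _+_ (sym (+-identityʳ _)) (middle-w≡kσ j α<j j≤i₁) ⟩
    outer Dw j + 0 + kσⱼ          ≡⟨ cong (λ m → outer Dw j + m + kσⱼ) (middle-ws-≢α j j≤n (>⇒≢ α<j)) ⟨
    outer Dw j + middle Dws j + kσⱼ ≡⟨ cong (_+ kσⱼ) (count-ws≡outer+middle j) ⟨
    count n Dws j + kσⱼ           ∎
    where
    open ≡-Reasoning
    j≤n = ≤-trans j≤i₁ i₁≤n
    kσⱼ = count β Dσ (j ∸ α)

  k-formula : ∀ j → InBox n j →
    KPrime α i₁ (map (count n Dws) (range1 n)) (map (count β Dσ) (range1 β)) (map (count n Dw) (range1 n)) j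
  k-formula j j∈@(_ , j≤n) rewrite at-map-range1 (count n Dw) n j j∈ | at-map-range1 (count n Dws) n j j∈ =
      (λ j<α → count-off-block j j≤n (inj₁ j<α))
    , (λ { refl → count-α })
    , (λ α<j j≤i₁ → trans (count-block j α<j j≤i₁)
                          (cong (_ +_) (sym (at-map-range1 (count β Dσ) β (j ∸ α) (m<n⇒0<n∸m α<j , ≤i₁⇒∸α≤β j≤i₁)))))
    , (λ i₁<j → count-off-block j j≤n (inj₂ i₁<j))

proposition4p4 : (n : ℕ) (w : List ℕ) (h α i₁ β : ℕ) →
    IsPerm n w → PrimaryData n w h α i₁ β →
    (is ks ms : List ℕ) → OrthData n (wsort w α i₁) is ks ms →
    (isσ kσ msσ : List ℕ) → OrthData β (sigma w h α β) isσ kσ msσ →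
    ∃ λ ks' → OrthData n w is ks' ms × (length ks' ≡ n)
      × (∀ j → 1 ≤ j → j ≤ n → KPrime α i₁ ks kσ ks' j)
proposition4p4 n w h α i₁ β w-perm primary is _ ms (refl , orth) _ _ _ (refl , _) =
  map (count n Dw) (range1 n) ,
  (refl , Orth-resp-≐ clear0-ws≐clear0-w orth) ,
  trans (length-map _ (range1 n)) (length-range1 n) ,
  λ j 1≤j j≤n → k-formula j (1≤j , j≤n)
  where open BlockSorting w-perm primary
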